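{- Let $\Phi=(V,\mathscr{C})$ be a hypergraph with $V=[n]$. If there exist a constant $\varepsilon\in(0,1)$ and a function $x:\mathscr{C}\to(0,1)$ such that \[ \forall C\in\mathscr{C}:\quad 2\lvert C\rvert\cdot 2^{ -\lvert C\rvert}\le(1-\varepsilon)\cdot x(C)\cdot\prod_{C'\in\Gamma_{\Phi^2}(C)}(1-x(C')), \] then for all $L\in\mathbb{N}$, \[ \Pr[\mathscr{B}_L]\le\sum_{C\in\mathscr{C}}\frac{x(C)}{1-x(C)}\cdot(1-\varepsilon)^{\lfloor\frac{L+1}{2}\rfloor}. \]
   Context: $\Phi=(V,\mathscr{C})$ has vertex set $V=[n]$ and hyperedges $\mathscr{C}$ (nonempty subsets of $V$). $\Gamma^+_{\Phi^2}(C)$ is the set of $C'\in\mathscr{C}$ with $C\cap C'\neq\emptyset$ or such that some $C^*\in\mathscr{C}$ satisfies $C\cap C^*\neq\emptyset\neq C^*\cap C'$; $\Gamma_{\Phi^2}(C):=\Gamma^+_{\Phi^2}(C)\setminus\{C\}$. Scan sequence $v_i:=(i\bmod n)+1$. $\mathrm{UpdTime}(v,t):=\max\{t^*\le t:v_{t^*}=v\}$. For $C\in\mathscr{C}$ and integer $t$, $e_{C,t}:=\{\mathrm{UpdTime}(v,t):v\in C\}$ (a set of time points) with label $C$. For $T\in\mathbb{N}$ the witness graph $H_T$ is the directed graph on $V_T:=\{e_{C,t}:t\in[T],C\in\mathscr{C},v_t\in C\}$ (vertices regarded as pairs $(C,t)$) with an edge $e_{C,t}\to e_{C',t'}$ iff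 $t'<t$ and $e_{C,t}\cap e_{C',t'}\neq\emptyset$. An induced path of length $\ell$ is a sequence $(e_1,\dots,e_\ell)$ of distinct vertices with $e_i\to e_{i+1}$ an edge for each $i<\ell$ and no other edges of $H_T$ among them. Each time point $t\in[T]$ carries an independent $\mathrm{Bern}(1/2)$ variable $B_t$; a vertex $e$ is open if $B_t=1$ for all $t\in e$, and a set of vertices is open if all members are. For $L\in\mathbb{N}$ and $T=n(L+1)$, $\mathscr{B}_L$ is the event that $H_T$ contains an open induced path $(e_1,\dots,e_L)$ of length $L$ with $e_1\cap(T-n,T]\neq\emptyset$.
   Formalization: The constant ε is rational and the function x takes rational values in (0,1). -}

module Defs where

open import Data.Bool using (Bool; true; false)
open import Data.Empty using (⊥)
open import Data.Fin using (Fin; zero; suc; toℕ; fromℕ<)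
open import Data.Fin.Subset using (Subset; _∈_; _∩_; Nonempty; ∣_∣)
open import Data.Fin.Subset.Properties using (nonempty?)
open import Data.Fin.Properties using (any?)
import Data.Fin.Properties as FinP
open import Data.Integer as ℤ using (ℤ; +_; -[1+_]; _%ℕ_)
open import Data.List using (List; length)
open import Data.List.Relation.Unary.All using (All)
open import Data.List.Relation.Unary.Unique.Propositional using (Unique)
open import Data.Nat as ℕ using (ℕ; NonZero; _∸_; _<?_)
open import Data.Product using (Σ; ∃; _×_; _,_)
open import Data.Rational as ℚ using (ℚ; 0ℚ; 1ℚ; _÷_; ≢-nonZero)
open import Data.Rational.Properties using () renaming (_≟_ to _≟ℚ_)
open import Data.Sum using (_⊎_)
open import Data.Vec using (Vec; lookup)
open import Relation.Binary.PropositionalEquality using (_≡_; _≢_)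
open import Relation.Nullary using (Dec; yes; no; ¬_)
open import Relation.Nullary.Decidable using (_⊎-dec_; _×-dec_; ¬?)

-- Hypergraphs Φ = (V, 𝒞) with V = [n].
-- Vertex k ∈ [n] is represented by (k-1) : Fin n.
-- The hyperedge set 𝒞 is enumerated without repetition as C : Fin m → Subset n.

record Hypergraph (n : ℕ) : Set where
  field
    m         : ℕ
    edge      : Fin m → Subset n
    nonempty  : ∀ i → Nonempty (edge i)
    injective : ∀ i j → edge i ≡ edge j → i ≡ j

open Hypergraph public

∑ : (m : ℕ) → (Fin m → ℚ) → ℚ
∑ ℕ.zero    f = 0ℚ
∑ (ℕ.suc m) f = f zero ℚ.+ ∑ m (λ i → f (suc i))

∏ : (m : ℕ) → (Fin m → ℚ) → ℚ
∏ ℕ.zero    f = 1ℚ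
∏ (ℕ.suc m) f = f zero ℚ.* ∏ m (λ i → f (suc i))

_^ℚ_ : ℚ → ℕ → ℚ
q ^ℚ ℕ.zero  = 1ℚ
q ^ℚ ℕ.suc k = q ℚ.* (q ^ℚ k)

-- a / (1 - a)   (the value at a = 1 is irrelevant; there we return 0)
odds : ℚ → ℚ
odds a with (1ℚ ℚ.- a) ≟ℚ 0ℚ
... | yes _  = 0ℚ
... | no ne  = _÷_ a (1ℚ ℚ.- a) {{≢-nonZero ne}}

module _ {n : ℕ} (Φ : Hypergraph n) where

  Meets : Fin (m Φ) → Fin (m Φ) → Set
  Meets i j = Nonempty (edge Φ i ∩ edge Φ j)

  meets? : ∀ i j → Dec (Meets i j)
  meets? i j = nonempty? (edge Φ i ∩ edge Φ j)

  Γ⁺ : Fin (m Φ) → Fin (m Φ) → Set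
  Γ⁺ i j = Meets i j ⊎ ∃ λ k → Meets i k × Meets k j

  Γ⁺? : ∀ i j → Dec (Γ⁺ i j)
  Γ⁺? i j = meets? i j ⊎-dec any? (λ k → meets? i k ×-dec meets? k j)

  Γ : Fin (m Φ) → Fin (m Φ) → Set
  Γ i j = Γ⁺ i j × i ≢ j

  Γ? : ∀ i j → Dec (Γ i j)
  Γ? i j = Γ⁺? i j ×-dec ¬? (i FinP.≟ j)

  prodΓ : (Fin (m Φ) → ℚ) → Fin (m Φ) → ℚ
  prodΓ x i = ∏ (m Φ) (λ j → factor j (Γ? i j))
    where
    factor : ∀ j → Dec (Γ i j) → ℚ
    factor j (yes _) = 1ℚ ℚ.- x j
    factor j (no _)  = 1ℚ

module Scan (n : ℕ) .{{_ : NonZero n}} where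

  -- v_t = (t mod n) + 1, represented 0-based: toℕ (v_t) = t mod n
  IsScanned : Fin n → ℤ → Set
  IsScanned v t = toℕ v ≡ t %ℕ n

  -- UpdTime(v,t) = max{t* ≤ t : v_{t*} = v} = t - ((t - v) mod n)  (v 0-based)
  UpdTime : Fin n → ℤ → ℤ
  UpdTime v t = t ℤ.- + ((t ℤ.- + toℕ v) %ℕ n)

module Witness {n : ℕ} .{{nz : NonZero n}} (Φ : Hypergraph n) (T : ℕ) where

  open Scan n

  _∈e[_,_] : ℤ → Fin (m Φ) → ℤ → Set
  u ∈e[ c , t ] = ∃ λ v → v ∈ edge Φ c × UpdTime v t ≡ u

  IsVertex : Fin (m Φ) → ℤ → Set
  IsVertex c t = + 1 ℤ.≤ t × t ℤ.≤ + T × ∃ λ v → v ∈ edge Φ c × IsScanned v t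

  Intersect : Fin (m Φ) → ℤ → Fin (m Φ) → ℤ → Set
  Intersect c t c' t' = ∃ λ u → u ∈e[ c , t ] × u ∈e[ c' , t' ]

  Edge : Fin (m Φ) → ℤ → Fin (m Φ) → ℤ → Set
  Edge c t c' t' = t' ℤ.< t × Intersect c t c' t'

  record InducedPath (L : ℕ) (cs : Fin L → Fin (m Φ)) (ts : Fin L → ℤ) : Set where
    field
      vertices : ∀ i → IsVertex (cs i) (ts i)
      distinct : ∀ i j → i ≢ j → cs i ≢ cs j ⊎ ts i ≢ ts j
      edges    : ∀ i j → ℕ.suc (toℕ i) ≡ toℕ j → Edge (cs i) (ts i) (cs j) (ts j)
      induced  : ∀ i j → Edge (cs i) (ts i) (cs j) (ts j) → ℕ.suc (toℕ i) ≡ toℕ j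

  Open : (ℤ → Bool) → Fin (m Φ) → ℤ → Set
  Open B c t = ∀ u → u ∈e[ c , t ] → B u ≡ true

  Event : (L : ℕ) → (ℤ → Bool) → Set
  Event L B = Σ (Fin L → Fin (m Φ)) λ cs → Σ (Fin L → ℤ) λ ts →
      InducedPath L cs ts
    × (∀ i → Open B (cs i) (ts i))
    × (∃ λ (i : Fin L) → toℕ i ≡ 0 × ∃ λ u → u ∈e[ cs i , ts i ]
          × (+ T ℤ.- + n) ℤ.< u × u ℤ.≤ + T)

-- Probability space: the independent fair bits B_t.  All time points that
-- can ever occur in some e_{C,t} with t ∈ [T] lie in the window
-- [1-n, T]; we use one fair bit for each time point of that window,
-- encoded as a vector of length T + n (index k ↔ time k + 1 - n).
-- Bits outside the window are never inspected (set to true).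

bits : {n W : ℕ} → Vec Bool W → ℤ → Bool
bits {n} {W} ω u with u ℤ.+ + (n ∸ 1)
... | -[1+ _ ] = true
... | + k with k <? W
...   | yes k<W = lookup ω (fromℕ< k<W)
...   | no _    = true

-- Pr[P] ≤ p for a predicate P on the uniform space Bool^W:
-- #{ω : P ω} ≤ p · 2^W, i.e. every duplicate-free list of outcomes
-- satisfying P has length ≤ p · 2^W.
PrAtMost : (W : ℕ) → (Vec Bool W → Set) → ℚ → Set
PrAtMost W P p = ∀ (S : List (Vec Bool W)) → Unique S → All P S →
  (+ length S) ℚ./ 1 ℚ.≤ p ℚ.* ((+ (2 ℕ.^ W)) ℚ./ 1)

PrBAtMost : {n : ℕ} .{{_ : NonZero n}} → Hypergraph n → ℕ → ℚ → Set
PrBAtMost {n} Φ L p =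
  PrAtMost (T ℕ.+ n) (λ ω → Witness.Event Φ T L (bits {n} ω)) p
  where T = n ℕ.* (L ℕ.+ 1)

module Submission where

-- Keep every second vertex e₁, e₃, e₅, … of an open induced path.  Two kept
-- consecutive vertices e_{C,t}, e_{C″,t″} satisfy C″ ∈ Γ⁺_{Φ²}(C), and t″ is the
-- last update time of some v ∈ C″ within the n steps before t or within the n
-- steps before those, so each step is one of 2|C″| choices.  Vertices at
-- distance ≥ 2 on an induced path have disjoint time sets, so the kept vertices
-- are jointly open with probability 2^{-Σ|C|}.  The union bound over all choices
-- bounds Pr[𝓑_L] by Σ_C |C| 2^{-|C|} H_K(C) with K = ⌊(L-1)/2⌋ and
-- H_{j+1}(C) = Σ_{C″ ∈ Γ⁺(C)} 2|C″| 2^{-|C″|} H_j(C″).  The hypothesis and the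
-- inequality ∏ (1 - aᵢ) · Σ aᵢ/(1 - aᵢ) ≤ 1 give H_j(C) ∏_{Γ⁺(C)} (1 - x) ≤ (1 - ε)^j
-- by induction on j, and hence the bound.

open import Defs
open import Data.Fin using (Fin)
open import Data.Fin.Subset using (∣_∣)
open import Data.Integer using (+_)
open import Data.Nat using (ℕ; NonZero; _/_; _+_; _*_; _^_)
open import Data.Product using (_×_)
open import Data.Rational using (ℚ; 0ℚ; 1ℚ; _<_; _≤_; _-_; ½)
import Data.Rational as Q

open import Data.Bool using (Bool; true; false)
open import Data.Empty using (⊥; ⊥-elim)
open import Data.Fin using (zero; suc; toℕ; fromℕ<)
import Data.Fin.Properties as Fin
open import Data.Fin.Subset using (Subset) renaming (_∈_ to _∈ₛ_)
open import Data.Fin.Subset.Properties using (x∈p∩q⁺)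
open import Data.Integer as ℤ using (ℤ; _%ℕ_; _/ℕ_)
import Data.Integer.Properties as ℤ
open import Data.Integer.DivMod using (a≡a%ℕn+[a/ℕn]*n; n%ℕd<d)
import Data.Integer.Tactic.RingSolver as ℤ
open import Data.List using (List; []; _∷_; length; map; _++_)
open import Data.List.Properties using (length-map; length-++)
open import Data.List.Membership.Propositional using (_∈_; _∉_)
open import Data.List.Membership.Propositional.Properties using (∈-map⁻; ∈-++⁻)
open import Data.List.Relation.Unary.All as All using (All; []; _∷_)
import Data.List.Relation.Unary.All.Properties as All
open import Data.List.Relation.Unary.AllPairs using ([]; _∷_)
open import Data.List.Relation.Unary.Any using (here; there)
open import Data.List.Relation.Unary.Unique.Propositional using (Unique)
import Data.List.Relation.Unary.Unique.Propositional.Properties as Unique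
open import Data.Nat as ℕ using (zero; suc; _∸_)
import Data.Nat.Coprimality as Coprime
import Data.Nat.DivMod as ℕ
import Data.Nat.Properties as ℕ
import Data.Nat.Tactic.RingSolver as ℕ
open import Data.Product using (Σ; _,_; proj₁; proj₂)
open import Data.Rational as ℚ using (1/_)
import Data.Rational.Properties as ℚ
open import Data.Rational.Solver using (module +-*-Solver)
open import Data.Sum using (_⊎_; inj₁; inj₂; swap)
open import Data.Vec as Vec using (Vec; []; _∷_; lookup; _[_]≔_)
open import Data.Vec.Properties using (lookup∘update; lookup∘update′; []≔-idempotent; []≔-lookup)
open import Relation.Binary.PropositionalEquality
open import Relation.Nullary using (¬_; Dec; yes; no)

open +-*-Solver using (solve; con; _:+_; _:*_; _:-_; _:=_)

∷-unique : ∀ {A : Set} {x : A} {xs} → x ∉ xs → Unique xs → Unique (x ∷ xs)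
∷-unique x∉ u = All.tabulate (λ { y∈ refl → x∉ y∈ }) ∷ u

module _ {W : ℕ} where

  splitByHead : List (Vec Bool (suc W)) → List (Vec Bool W) × List (Vec Bool W)
  splitByHead [] = [] , []
  splitByHead ((true ∷ ω) ∷ S) = ω ∷ proj₁ (splitByHead S) , proj₂ (splitByHead S)
  splitByHead ((false ∷ ω) ∷ S) = proj₁ (splitByHead S) , ω ∷ proj₂ (splitByHead S)

  length-splitByHead : ∀ S → length S ≡ length (proj₁ (splitByHead S)) + length (proj₂ (splitByHead S))
  length-splitByHead [] = refl
  length-splitByHead ((true ∷ ω) ∷ S) = cong suc (length-splitByHead S)
  length-splitByHead ((false ∷ ω) ∷ S) = trans (cong suc (length-splitByHead S)) (sym (ℕ.+-suc _ _))

  ∈-splitByHead₁ : ∀ S {ω} → ω ∈ proj₁ (splitByHead S) → (true ∷ ω) ∈ S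
  ∈-splitByHead₁ ((true ∷ _) ∷ S) (here refl) = here refl
  ∈-splitByHead₁ ((true ∷ _) ∷ S) (there ω∈) = there (∈-splitByHead₁ S ω∈)
  ∈-splitByHead₁ ((false ∷ _) ∷ S) ω∈ = there (∈-splitByHead₁ S ω∈)

  ∈-splitByHead₂ : ∀ S {ω} → ω ∈ proj₂ (splitByHead S) → (false ∷ ω) ∈ S
  ∈-splitByHead₂ ((false ∷ _) ∷ S) (here refl) = here refl
  ∈-splitByHead₂ ((false ∷ _) ∷ S) (there ω∈) = there (∈-splitByHead₂ S ω∈)
  ∈-splitByHead₂ ((true ∷ _) ∷ S) ω∈ = there (∈-splitByHead₂ S ω∈)

  splitByHead-unique₁ : ∀ {S} → Unique S → Unique (proj₁ (splitByHead S))
  splitByHead-unique₁ {[]} _ = []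
  splitByHead-unique₁ {(true ∷ _) ∷ S} u@(_ ∷ u′) =
    ∷-unique (λ ω∈ → Unique.Unique[x∷xs]⇒x∉xs u (∈-splitByHead₁ S ω∈)) (splitByHead-unique₁ u′)
  splitByHead-unique₁ {(false ∷ _) ∷ S} (_ ∷ u′) = splitByHead-unique₁ u′

  splitByHead-unique₂ : ∀ {S} → Unique S → Unique (proj₂ (splitByHead S))
  splitByHead-unique₂ {[]} _ = []
  splitByHead-unique₂ {(false ∷ _) ∷ S} u@(_ ∷ u′) =
    ∷-unique (λ ω∈ → Unique.Unique[x∷xs]⇒x∉xs u (∈-splitByHead₂ S ω∈)) (splitByHead-unique₂ u′)
  splitByHead-unique₂ {(true ∷ _) ∷ S} (_ ∷ u′) = splitByHead-unique₂ u′

length≤2^W : ∀ W (S : List (Vec Bool W)) → Unique S → length S ℕ.≤ 2 ^ W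
length≤2^W zero [] _ = ℕ.z≤n
length≤2^W zero ([] ∷ []) _ = ℕ.s≤s ℕ.z≤n
length≤2^W zero ([] ∷ [] ∷ _) ((≢ ∷ _) ∷ _) = ⊥-elim (≢ refl)
length≤2^W (suc W) S u = begin
  length S       ≡⟨ length-splitByHead S ⟩
  length (proj₁ (splitByHead S)) + length (proj₂ (splitByHead S))
    ≤⟨ ℕ.+-mono-≤ (length≤2^W W _ (splitByHead-unique₁ u)) (length≤2^W W _ (splitByHead-unique₂ u)) ⟩
  2 ^ W + 2 ^ W  ≡⟨ cong (λ k → 2 ^ W + k) (sym (ℕ.+-identityʳ _)) ⟩
  2 ^ suc W      ∎
  where open ℕ.≤-Reasoning

TrueAt : ∀ {W} → List (Fin W) → Vec Bool W → Set
TrueAt ps ω = All (λ p → lookup ω p ≡ true) ps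

-- Clearing a bit that is known to be set loses no information, and sends
-- the vectors true on p ∷ ps to vectors true on ps that are false at p.
module _ {W : ℕ} (p : Fin W) where

  clear : Vec Bool W → Vec Bool W
  clear ω = ω [ p ]≔ false

  clear-injective : ∀ {ω ω′} → lookup ω p ≡ true → lookup ω′ p ≡ true → clear ω ≡ clear ω′ → ω ≡ ω′
  clear-injective {ω} {ω′} ωp ω′p eq = begin
    ω                      ≡⟨ sym ([]≔-lookup ω p) ⟩
    ω [ p ]≔ lookup ω p    ≡⟨ cong (ω [ p ]≔_) ωp ⟩
    ω [ p ]≔ true          ≡⟨ sym ([]≔-idempotent ω p) ⟩
    clear ω [ p ]≔ true    ≡⟨ cong (_[ p ]≔ true) eq ⟩
    clear ω′ [ p ]≔ true   ≡⟨ []≔-idempotent ω′ p ⟩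
    ω′ [ p ]≔ true         ≡⟨ cong (ω′ [ p ]≔_) (sym ω′p) ⟩
    ω′ [ p ]≔ lookup ω′ p  ≡⟨ []≔-lookup ω′ p ⟩
    ω′                     ∎
    where open ≡-Reasoning

  lookup-clear : ∀ ω → lookup (clear ω) p ≡ false
  lookup-clear ω = lookup∘update p ω false

  clear-∉ : ∀ {ω S} → ω ∉ S → lookup ω p ≡ true → All (λ ω → lookup ω p ≡ true) S → clear ω ∉ map clear S
  clear-∉ {S = S} ω∉ ωp Sp cω∈ with ∈-map⁻ clear cω∈
  ... | ω′ , ω′∈ , eq = ω∉ (subst (_∈ S) (sym (clear-injective ωp (All.lookup Sp ω′∈) eq)) ω′∈)

  map-clear-unique : ∀ {S} → Unique S → All (λ ω → lookup ω p ≡ true) S → Unique (map clear S)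
  map-clear-unique {[]} _ _ = []
  map-clear-unique {ω ∷ S} u@(_ ∷ u′) (ωp ∷ Sp) =
    ∷-unique (clear-∉ (Unique.Unique[x∷xs]⇒x∉xs u) ωp Sp) (map-clear-unique u′ Sp)

  clear-∉-map : ∀ {ω S} → lookup ω p ≡ true → ω ∉ map clear S
  clear-∉-map {ω} ωp ω∈ with ∈-map⁻ clear ω∈
  ... | ω′ , _ , refl with () ← trans (sym ωp) (lookup-clear ω′)

  TrueAt-clear : ∀ {ps ω} → p ∉ ps → TrueAt ps ω → TrueAt ps (clear ω)
  TrueAt-clear {ω = ω} p∉ ωps = All.tabulate λ q∈ → trans (lookup∘update′ (λ { refl → p∉ q∈ }) ω false) (All.lookup ωps q∈)

length*2^ps≤2^W : ∀ W (ps : List (Fin W)) (S : List (Vec Bool W)) → Unique ps → Unique S →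
  All (TrueAt ps) S → length S * 2 ^ length ps ℕ.≤ 2 ^ W
length*2^ps≤2^W W [] S _ uS _ = subst (ℕ._≤ 2 ^ W) (sym (ℕ.*-identityʳ _)) (length≤2^W W S uS)
length*2^ps≤2^W W (p ∷ ps) S (p∉ ∷ ups) uS aS = begin
  length S * (2 * 2 ^ length ps)          ≡⟨ double (length S) (2 ^ length ps) ⟩
  (length S + length S) * 2 ^ length ps   ≡⟨ cong (λ k → (length S + k) * _) (sym (length-map (clear p) S)) ⟩
  (length S + length S′) * 2 ^ length ps  ≡⟨ cong (_* _) (sym (length-++ S)) ⟩
  length (S ++ S′) * 2 ^ length ps        ≤⟨ length*2^ps≤2^W W ps (S ++ S′) ups unique true-on-ps ⟩
  2 ^ W                                   ∎
  where
  open ℕ.≤-Reasoning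
  S′ = map (clear p) S
  p∉ps : p ∉ ps
  p∉ps p∈ = All.lookup p∉ p∈ refl
  true-at-p : All (λ ω → lookup ω p ≡ true) S
  true-at-p = All.map All.head aS
  unique : Unique (S ++ S′)
  unique = Unique.++⁺ uS (map-clear-unique p uS true-at-p) λ (ω∈S , ω∈S′) →
    clear-∉-map p (All.lookup true-at-p ω∈S) ω∈S′
  true-on-ps : All (TrueAt ps) (S ++ S′)
  true-on-ps = All.++⁺ (All.map All.tail aS) (All.map⁺ (All.map (λ {ω} a → TrueAt-clear p {ω = ω} p∉ps (All.tail a)) aS))
  double : ∀ a b → a * (2 * b) ≡ (a + a) * b
  double a b = trans (sym (ℕ.*-assoc a 2 b)) (cong (_* b) (trans (ℕ.*-comm a 2) (cong (λ k → a + k) (ℕ.+-identityʳ a))))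

fromℕ : ℕ → ℚ
fromℕ k = + k ℚ./ 1

fromℕ-suc : ∀ k → fromℕ (suc k) ≡ 1ℚ ℚ.+ fromℕ k
fromℕ-suc k = begin
  fromℕ (suc k)                        ≡⟨ ℚ./-cong (cong (λ z → + 1 ℤ.+ z) (sym (ℤ.*-identityʳ (+ k)))) refl ⟩
  (+ 1 ℤ.* + 1 ℤ.+ + k ℤ.* + 1) ℚ./ 1  ≡⟨⟩
  1ℚ ℚ.+ ℚ.mkℚ (+ k) 0 k⊥1             ≡⟨ cong (1ℚ ℚ.+_) (sym (ℚ.normalize-coprime k⊥1)) ⟩
  1ℚ ℚ.+ fromℕ k                       ∎
  where
  open ≡-Reasoning
  k⊥1 = Coprime.sym (Coprime.1-coprimeTo k)

fromℕ-+ : ∀ a b → fromℕ (a + b) ≡ fromℕ a ℚ.+ fromℕ b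
fromℕ-+ zero b = sym (ℚ.+-identityˡ (fromℕ b))
fromℕ-+ (suc a) b = begin
  fromℕ (suc (a + b))           ≡⟨ fromℕ-suc (a + b) ⟩
  1ℚ ℚ.+ fromℕ (a + b)          ≡⟨ cong (1ℚ ℚ.+_) (fromℕ-+ a b) ⟩
  1ℚ ℚ.+ (fromℕ a ℚ.+ fromℕ b)  ≡⟨ sym (ℚ.+-assoc 1ℚ (fromℕ a) (fromℕ b)) ⟩
  (1ℚ ℚ.+ fromℕ a) ℚ.+ fromℕ b  ≡⟨ cong (ℚ._+ fromℕ b) (sym (fromℕ-suc a)) ⟩
  fromℕ (suc a) ℚ.+ fromℕ b     ∎
  where open ≡-Reasoning

fromℕ-* : ∀ a b → fromℕ (a * b) ≡ fromℕ a ℚ.* fromℕ b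
fromℕ-* zero b = sym (ℚ.*-zeroˡ (fromℕ b))
fromℕ-* (suc a) b = begin
  fromℕ (b + a * b)                       ≡⟨ fromℕ-+ b (a * b) ⟩
  fromℕ b ℚ.+ fromℕ (a * b)               ≡⟨ cong (fromℕ b ℚ.+_) (fromℕ-* a b) ⟩
  fromℕ b ℚ.+ fromℕ a ℚ.* fromℕ b         ≡⟨ cong (ℚ._+ fromℕ a ℚ.* fromℕ b) (sym (ℚ.*-identityˡ (fromℕ b))) ⟩
  1ℚ ℚ.* fromℕ b ℚ.+ fromℕ a ℚ.* fromℕ b  ≡⟨ sym (ℚ.*-distribʳ-+ (fromℕ b) 1ℚ (fromℕ a)) ⟩
  (1ℚ ℚ.+ fromℕ a) ℚ.* fromℕ b            ≡⟨ cong (ℚ._* fromℕ b) (sym (fromℕ-suc a)) ⟩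
  fromℕ (suc a) ℚ.* fromℕ b               ∎
  where open ≡-Reasoning

0≤fromℕ : ∀ k → 0ℚ ≤ fromℕ k
0≤fromℕ k = ℚ.nonNegative⁻¹ _ {{ℚ.normalize-nonNeg k 1}}

fromℕ-mono-≤ : ∀ {a b} → a ℕ.≤ b → fromℕ a ≤ fromℕ b
fromℕ-mono-≤ {a} {b} a≤b = begin
  fromℕ a                      ≡⟨ sym (ℚ.+-identityʳ (fromℕ a)) ⟩
  fromℕ a ℚ.+ 0ℚ               ≤⟨ ℚ.+-monoʳ-≤ (fromℕ a) (0≤fromℕ (b ℕ.∸ a)) ⟩
  fromℕ a ℚ.+ fromℕ (b ℕ.∸ a)  ≡⟨ sym (fromℕ-+ a (b ℕ.∸ a)) ⟩
  fromℕ (a + (b ℕ.∸ a))        ≡⟨ cong fromℕ (ℕ.m+[n∸m]≡n a≤b) ⟩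
  fromℕ b                      ∎
  where open ℚ.≤-Reasoning

0≤* : ∀ {a b} → 0ℚ ≤ a → 0ℚ ≤ b → 0ℚ ≤ a ℚ.* b
0≤* {a} {b} 0≤a 0≤b =
  ℚ.nonNegative⁻¹ _ {{ℚ.nonNeg*nonNeg⇒nonNeg a {{ℚ.nonNegative 0≤a}} b {{ℚ.nonNegative 0≤b}}}}

*-mono-≤-nonNeg : ∀ {a b c d} → 0ℚ ≤ b → 0ℚ ≤ c → a ≤ b → c ≤ d → a ℚ.* c ≤ b ℚ.* d
*-mono-≤-nonNeg {a} {b} {c} {d} 0≤b 0≤c a≤b c≤d = begin
  a ℚ.* c  ≤⟨ ℚ.*-monoʳ-≤-nonNeg c {{ℚ.nonNegative 0≤c}} a≤b ⟩
  b ℚ.* c  ≤⟨ ℚ.*-monoˡ-≤-nonNeg b {{ℚ.nonNegative 0≤b}} c≤d ⟩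
  b ℚ.* d  ∎
  where open ℚ.≤-Reasoning

^ℚ-+ : ∀ q a b → q ^ℚ (a + b) ≡ q ^ℚ a ℚ.* q ^ℚ b
^ℚ-+ q zero b = sym (ℚ.*-identityˡ _)
^ℚ-+ q (suc a) b = trans (cong (q ℚ.*_) (^ℚ-+ q a b)) (sym (ℚ.*-assoc q (q ^ℚ a) (q ^ℚ b)))

0≤^ℚ : ∀ {q} → 0ℚ ≤ q → ∀ k → 0ℚ ≤ q ^ℚ k
0≤^ℚ _ zero = ℚ.nonNegative⁻¹ 1ℚ
0≤^ℚ 0≤q (suc k) = 0≤* 0≤q (0≤^ℚ 0≤q k)

0≤½^ : ∀ k → 0ℚ ≤ ½ ^ℚ k
0≤½^ = 0≤^ℚ (ℚ.nonNegative⁻¹ ½)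

2^*½^≡1 : ∀ k → fromℕ (2 ^ k) ℚ.* ½ ^ℚ k ≡ 1ℚ
2^*½^≡1 zero = refl
2^*½^≡1 (suc k) = begin
  fromℕ (2 * 2 ^ k) ℚ.* (½ ℚ.* ½ ^ℚ k)            ≡⟨ cong (ℚ._* (½ ℚ.* ½ ^ℚ k)) (fromℕ-* 2 (2 ^ k)) ⟩
  (fromℕ 2 ℚ.* fromℕ (2 ^ k)) ℚ.* (½ ℚ.* ½ ^ℚ k)  ≡⟨ interchange (fromℕ 2) (fromℕ (2 ^ k)) ½ (½ ^ℚ k) ⟩
  (fromℕ 2 ℚ.* ½) ℚ.* (fromℕ (2 ^ k) ℚ.* ½ ^ℚ k)  ≡⟨ cong (1ℚ ℚ.*_) (2^*½^≡1 k) ⟩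
  1ℚ                                              ∎
  where
  open ≡-Reasoning
  interchange : ∀ a b c d → (a ℚ.* b) ℚ.* (c ℚ.* d) ≡ (a ℚ.* c) ℚ.* (b ℚ.* d)
  interchange = solve 4 (λ a b c d → (a :* b) :* (c :* d) := (a :* c) :* (b :* d)) refl

∑-cong : ∀ k {f g : Fin k → ℚ} → (∀ i → f i ≡ g i) → ∑ k f ≡ ∑ k g
∑-cong zero _ = refl
∑-cong (suc k) f≡g = cong₂ ℚ._+_ (f≡g zero) (∑-cong k (λ i → f≡g (suc i)))

∑-mono-≤ : ∀ k {f g : Fin k → ℚ} → (∀ i → f i ≤ g i) → ∑ k f ≤ ∑ k g
∑-mono-≤ zero _ = ℚ.≤-refl
∑-mono-≤ (suc k) f≤g = ℚ.+-mono-≤ (f≤g zero) (∑-mono-≤ k (λ i → f≤g (suc i)))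

0≤∑ : ∀ k {f : Fin k → ℚ} → (∀ i → 0ℚ ≤ f i) → 0ℚ ≤ ∑ k f
0≤∑ zero _ = ℚ.≤-refl
0≤∑ (suc k) 0≤f = ℚ.+-mono-≤ (0≤f zero) (0≤∑ k (λ i → 0≤f (suc i)))

∑-*ˡ : ∀ k a (f : Fin k → ℚ) → a ℚ.* ∑ k f ≡ ∑ k (λ i → a ℚ.* f i)
∑-*ˡ zero a _ = ℚ.*-zeroʳ a
∑-*ˡ (suc k) a f =
  trans (ℚ.*-distribˡ-+ a (f zero) _) (cong (a ℚ.* f zero ℚ.+_) (∑-*ˡ k a (λ i → f (suc i))))

∑-const : ∀ k a → ∑ k (λ _ → a) ≡ fromℕ k ℚ.* a
∑-const zero a = sym (ℚ.*-zeroˡ a)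
∑-const (suc k) a = begin
  a ℚ.+ ∑ k (λ _ → a)         ≡⟨ cong₂ ℚ._+_ (sym (ℚ.*-identityˡ a)) (∑-const k a) ⟩
  1ℚ ℚ.* a ℚ.+ fromℕ k ℚ.* a  ≡⟨ sym (ℚ.*-distribʳ-+ a 1ℚ (fromℕ k)) ⟩
  (1ℚ ℚ.+ fromℕ k) ℚ.* a      ≡⟨ cong (ℚ._* a) (sym (fromℕ-suc k)) ⟩
  fromℕ (suc k) ℚ.* a         ∎
  where open ≡-Reasoning

∏-cong : ∀ k {f g : Fin k → ℚ} → (∀ i → f i ≡ g i) → ∏ k f ≡ ∏ k g
∏-cong zero _ = refl
∏-cong (suc k) f≡g = cong₂ ℚ._*_ (f≡g zero) (∏-cong k (λ i → f≡g (suc i)))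

∏-update : ∀ k (f g : Fin k → ℚ) i → f i ≡ 1ℚ → (∀ j → j ≢ i → f j ≡ g j) → g i ℚ.* ∏ k f ≡ ∏ k g
∏-update (suc k) f g zero fi≡1 f≡g = begin
  g zero ℚ.* (f zero ℚ.* ∏ k (λ j → f (suc j)))  ≡⟨ cong (λ z → g zero ℚ.* (z ℚ.* ∏ k (λ j → f (suc j)))) fi≡1 ⟩
  g zero ℚ.* (1ℚ ℚ.* ∏ k (λ j → f (suc j)))      ≡⟨ cong (g zero ℚ.*_) (ℚ.*-identityˡ _) ⟩
  g zero ℚ.* ∏ k (λ j → f (suc j))               ≡⟨ cong (g zero ℚ.*_) (∏-cong k (λ j → f≡g (suc j) λ ())) ⟩
  g zero ℚ.* ∏ k (λ j → g (suc j))               ∎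
  where open ≡-Reasoning
∏-update (suc k) f g (suc i) fi≡1 f≡g = begin
  g (suc i) ℚ.* (f zero ℚ.* ∏ k (λ j → f (suc j)))  ≡⟨ solve 3 (λ a b c → a :* (b :* c) := b :* (a :* c)) refl (g (suc i)) (f zero) _ ⟩
  f zero ℚ.* (g (suc i) ℚ.* ∏ k (λ j → f (suc j)))  ≡⟨ cong₂ ℚ._*_ (f≡g zero λ ()) tail≡ ⟩
  g zero ℚ.* ∏ k (λ j → g (suc j))                  ∎
  where
  open ≡-Reasoning
  tail≡ = ∏-update k (λ j → f (suc j)) (λ j → g (suc j)) i fi≡1 λ j j≢i → f≡g (suc j) λ { refl → j≢i refl }

when : {A : Set} → Dec A → ℚ → ℚ
when (yes _) q = q
when (no _) q = 0ℚ

0≤when : ∀ {A : Set} (A? : Dec A) {q} → 0ℚ ≤ q → 0ℚ ≤ when A? q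
0≤when (yes _) 0≤q = 0≤q
0≤when (no _) _ = ℚ.≤-refl

when-mono-≤ : ∀ {A : Set} (A? : Dec A) {q r} → q ≤ r → when A? q ≤ when A? r
when-mono-≤ (yes _) q≤r = q≤r
when-mono-≤ (no _) _ = ℚ.≤-refl

*-when : ∀ {A : Set} (A? : Dec A) a q → a ℚ.* when A? q ≡ when A? (a ℚ.* q)
*-when (yes _) a q = refl
*-when (no _) a q = ℚ.*-zeroʳ a

module _ {A : Set} where

  lefts : {P Q : A → Set} {S : List A} → All (λ x → P x ⊎ Q x) S → List A
  lefts [] = []
  lefts {S = x ∷ _} (inj₁ _ ∷ w) = x ∷ lefts w
  lefts (inj₂ _ ∷ w) = lefts w

  All-lefts : ∀ {P Q : A → Set} {S} (w : All (λ x → P x ⊎ Q x) S) → All P (lefts w)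
  All-lefts [] = []
  All-lefts (inj₁ px ∷ w) = px ∷ All-lefts w
  All-lefts (inj₂ _ ∷ w) = All-lefts w

  ∈-lefts : ∀ {P Q : A → Set} {S} (w : All (λ x → P x ⊎ Q x) S) {x} → x ∈ lefts w → x ∈ S
  ∈-lefts (inj₁ _ ∷ w) (here refl) = here refl
  ∈-lefts (inj₁ _ ∷ w) (there x∈) = there (∈-lefts w x∈)
  ∈-lefts (inj₂ _ ∷ w) x∈ = there (∈-lefts w x∈)

  lefts-unique : ∀ {P Q : A → Set} {S} (w : All (λ x → P x ⊎ Q x) S) → Unique S → Unique (lefts w)
  lefts-unique [] _ = []
  lefts-unique (inj₁ _ ∷ w) u@(_ ∷ u′) =
    ∷-unique (λ x∈ → Unique.Unique[x∷xs]⇒x∉xs u (∈-lefts w x∈)) (lefts-unique w u′)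
  lefts-unique (inj₂ _ ∷ w) (_ ∷ u′) = lefts-unique w u′

  length-lefts+rights : ∀ {P Q : A → Set} {S} (w : All (λ x → P x ⊎ Q x) S) →
    length S ≡ length (lefts w) + length (lefts (All.map swap w))
  length-lefts+rights [] = refl
  length-lefts+rights (inj₁ _ ∷ w) = cong suc (length-lefts+rights w)
  length-lefts+rights (inj₂ _ ∷ w) = trans (cong suc (length-lefts+rights w)) (sym (ℕ.+-suc _ _))

module _ {W : ℕ} where

  PrAtMost-mono : ∀ {P Q : Vec Bool W → Set} {p q} → (∀ {ω} → Q ω → P ω) → p ≤ q →
    PrAtMost W P p → PrAtMost W Q q
  PrAtMost-mono Q⇒P p≤q Pr[P]≤p S u QS =
    ℚ.≤-trans (Pr[P]≤p S u (All.map Q⇒P QS)) (ℚ.*-monoʳ-≤-nonNeg _ {{ℚ.nonNegative (0≤fromℕ (2 ^ W))}} p≤q)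

  PrAtMost-≤ : ∀ {P : Vec Bool W → Set} {p q} → p ≤ q → PrAtMost W P p → PrAtMost W P q
  PrAtMost-≤ {P} = PrAtMost-mono {P = P} (λ Pω → Pω)

  PrAtMost-⊥ : ∀ {P : Vec Bool W → Set} {p} → (∀ {ω} → ¬ P ω) → 0ℚ ≤ p → PrAtMost W P p
  PrAtMost-⊥ _ 0≤p [] _ _ = 0≤* 0≤p (0≤fromℕ (2 ^ W))
  PrAtMost-⊥ ¬P _ (_ ∷ _) _ (Pω ∷ _) = ⊥-elim (¬P Pω)

  -- A does not depend on ω, so it may be assumed as soon as one outcome is counted.
  PrAtMost-× : ∀ {A : Set} {P : Vec Bool W → Set} {p} → (A → PrAtMost W P p) → 0ℚ ≤ p →
    PrAtMost W (λ ω → A × P ω) p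
  PrAtMost-× _ 0≤p [] _ _ = 0≤* 0≤p (0≤fromℕ (2 ^ W))
  PrAtMost-× h _ S@(_ ∷ _) u AP@((a , _) ∷ _) = h a S u (All.map (λ (_ , Pω) → Pω) AP)

  PrAtMost-when : ∀ {A : Set} {P : Vec Bool W → Set} {p} (A? : Dec A) → (A → PrAtMost W P p) →
    PrAtMost W (λ ω → A × P ω) (when A? p)
  PrAtMost-when {P = P} {p} (yes a) h = PrAtMost-mono {P = P} {p = p} (λ (_ , Pω) → Pω) ℚ.≤-refl (h a)
  PrAtMost-when (no ¬a) _ = PrAtMost-⊥ (λ (a , _) → ¬a a) ℚ.≤-refl

  -- The outcomes are split according to the given proofs of P ω ⊎ Q ω, so no
  -- decidability of P is needed.
  PrAtMost-⊎ : ∀ {P Q : Vec Bool W → Set} {p q} → PrAtMost W P p → PrAtMost W Q q →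
    PrAtMost W (λ ω → P ω ⊎ Q ω) (p ℚ.+ q)
  PrAtMost-⊎ {p = p} {q} Pr[P]≤p Pr[Q]≤q S u PQS = begin
    fromℕ (length S)                                 ≡⟨ cong fromℕ (length-lefts+rights PQS) ⟩
    fromℕ (length (lefts PQS) + length (lefts QPS))  ≡⟨ fromℕ-+ (length (lefts PQS)) _ ⟩
    fromℕ (length (lefts PQS)) ℚ.+ fromℕ (length (lefts QPS))
      ≤⟨ ℚ.+-mono-≤ (Pr[P]≤p _ (lefts-unique PQS u) (All-lefts PQS)) (Pr[Q]≤q _ (lefts-unique QPS u) (All-lefts QPS)) ⟩
    p ℚ.* fromℕ (2 ^ W) ℚ.+ q ℚ.* fromℕ (2 ^ W)      ≡⟨ sym (ℚ.*-distribʳ-+ _ p q) ⟩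
    (p ℚ.+ q) ℚ.* fromℕ (2 ^ W)                      ∎
    where
    open ℚ.≤-Reasoning
    QPS = All.map swap PQS

  PrAtMost-Σ : ∀ k {P : Fin k → Vec Bool W → Set} {p : Fin k → ℚ} → (∀ i → PrAtMost W (P i) (p i)) →
    PrAtMost W (λ ω → Σ (Fin k) λ i → P i ω) (∑ k p)
  PrAtMost-Σ zero _ = PrAtMost-⊥ (λ ()) ℚ.≤-refl
  PrAtMost-Σ (suc k) {P} {p} h =
    PrAtMost-mono {P = λ ω → P zero ω ⊎ Σ (Fin k) λ i → P (suc i) ω} {p = p zero ℚ.+ _} split ℚ.≤-refl
      (PrAtMost-⊎ {p = p zero} {q = ∑ k (λ i → p (suc i))} (h zero) (PrAtMost-Σ k (λ i → h (suc i))))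
    where
    split : ∀ {Q : Fin (suc k) → Set} → Σ (Fin (suc k)) Q → Q zero ⊎ Σ (Fin k) (λ i → Q (suc i))
    split (zero , x) = inj₁ x
    split (suc i , x) = inj₂ (i , x)

  PrAtMost-Σ-uniform : ∀ k {P : Fin k → Vec Bool W → Set} {p} → (∀ i → PrAtMost W (P i) p) →
    PrAtMost W (λ ω → Σ (Fin k) λ i → P i ω) (fromℕ k ℚ.* p)
  PrAtMost-Σ-uniform k {p = p} h = PrAtMost-≤ (ℚ.≤-reflexive (∑-const k p)) (PrAtMost-Σ k h)

  PrAtMost-TrueAt : ∀ (ps : List (Fin W)) → Unique ps → PrAtMost W (TrueAt ps) (½ ^ℚ length ps)
  PrAtMost-TrueAt ps ups S uS aS = begin
    fromℕ (length S)                                    ≡⟨ sym (ℚ.*-identityʳ _) ⟩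
    fromℕ (length S) ℚ.* 1ℚ                             ≡⟨ cong (fromℕ (length S) ℚ.*_) (sym (2^*½^≡1 (length ps))) ⟩
    fromℕ (length S) ℚ.* (fromℕ (2 ^ length ps) ℚ.* h)  ≡⟨ sym (ℚ.*-assoc (fromℕ (length S)) _ h) ⟩
    fromℕ (length S) ℚ.* fromℕ (2 ^ length ps) ℚ.* h    ≡⟨ cong (ℚ._* h) (sym (fromℕ-* (length S) _)) ⟩
    fromℕ (length S * 2 ^ length ps) ℚ.* h              ≤⟨ ℚ.*-monoʳ-≤-nonNeg h {{ℚ.nonNegative (0≤½^ (length ps))}}
                                                             (fromℕ-mono-≤ (length*2^ps≤2^W W ps S ups uS aS)) ⟩
    fromℕ (2 ^ W) ℚ.* h                                 ≡⟨ ℚ.*-comm _ h ⟩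
    h ℚ.* fromℕ (2 ^ W)                                 ∎
    where
    open ℚ.≤-Reasoning
    h = ½ ^ℚ length ps

  PrAtMost-Σ∈ : ∀ {n} (C : Subset n) {P : Fin n → Vec Bool W → Set} {p} → 0ℚ ≤ p →
    (∀ v → v ∈ₛ C → PrAtMost W (P v) p) →
    PrAtMost W (λ ω → Σ (Fin n) λ v → v ∈ₛ C × P v ω) (fromℕ ∣ C ∣ ℚ.* p)
  PrAtMost-Σ∈ [] {p = p} _ _ = PrAtMost-⊥ (λ { (() , _) }) (ℚ.≤-reflexive (sym (ℚ.*-zeroˡ p)))
  PrAtMost-Σ∈ (true ∷ C) {P} {p} 0≤p h =
    PrAtMost-mono {P = λ ω → P zero ω ⊎ Σ (Fin _) λ v → v ∈ₛ C × P (suc v) ω} split (ℚ.≤-reflexive count)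
      (PrAtMost-⊎ {p = p} {q = fromℕ ∣ C ∣ ℚ.* p} (h zero Vec.here) (PrAtMost-Σ∈ C 0≤p (λ v v∈ → h (suc v) (Vec.there v∈))))
    where
    split : ∀ {Q : Fin _ → Set} → Σ (Fin _) (λ v → v ∈ₛ (true ∷ C) × Q v) → Q zero ⊎ Σ (Fin _) λ v → v ∈ₛ C × Q (suc v)
    split (zero , Vec.here , x) = inj₁ x
    split (suc v , Vec.there v∈ , x) = inj₂ (v , v∈ , x)
    count : p ℚ.+ fromℕ ∣ C ∣ ℚ.* p ≡ fromℕ (suc ∣ C ∣) ℚ.* p
    count = trans (cong (ℚ._+ fromℕ ∣ C ∣ ℚ.* p) (sym (ℚ.*-identityˡ p)))
      (trans (sym (ℚ.*-distribʳ-+ p 1ℚ (fromℕ ∣ C ∣))) (cong (ℚ._* p) (sym (fromℕ-suc ∣ C ∣))))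
  PrAtMost-Σ∈ (false ∷ C) {P} {p} 0≤p h =
    PrAtMost-mono {P = λ ω → Σ (Fin _) λ v → v ∈ₛ C × P (suc v) ω} {p = fromℕ ∣ C ∣ ℚ.* p}
      (λ { (suc v , Vec.there v∈ , x) → v , v∈ , x }) ℚ.≤-refl (PrAtMost-Σ∈ C 0≤p (λ v v∈ → h (suc v) (Vec.there v∈)))

0<1-a : ∀ {a} → a < 1ℚ → 0ℚ < 1ℚ - a
0<1-a {a} a<1 = subst (_< 1ℚ - a) (ℚ.+-inverseʳ a) (ℚ.+-monoˡ-< (ℚ.- a) a<1)

1-a≤1 : ∀ {a} → 0ℚ ≤ a → 1ℚ - a ≤ 1ℚ
1-a≤1 {a} 0≤a = subst (1ℚ - a ≤_) (ℚ.+-identityʳ 1ℚ) (ℚ.+-monoʳ-≤ 1ℚ (ℚ.neg-antimono-≤ 0≤a))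

[1-a]*odds≡a : ∀ {a} → a < 1ℚ → (1ℚ - a) ℚ.* odds a ≡ a
[1-a]*odds≡a {a} a<1 with (1ℚ - a) ℚ.≟ 0ℚ
... | yes 1-a≡0 = ⊥-elim (ℚ.<-irrefl (sym 1-a≡0) (0<1-a a<1))
... | no 1-a≢0 = begin
  (1ℚ - a) ℚ.* (a ℚ.* 1/ (1ℚ - a))  ≡⟨ solve 3 (λ b a c → b :* (a :* c) := a :* (b :* c)) refl (1ℚ - a) a _ ⟩
  a ℚ.* ((1ℚ - a) ℚ.* 1/ (1ℚ - a))  ≡⟨ cong (a ℚ.*_) (ℚ.*-inverseʳ (1ℚ - a)) ⟩
  a ℚ.* 1ℚ                          ≡⟨ ℚ.*-identityʳ a ⟩
  a                                 ∎
  where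
  open ≡-Reasoning
  instance _ = ℚ.≢-nonZero 1-a≢0

0≤odds : ∀ {a} → 0ℚ ≤ a → a < 1ℚ → 0ℚ ≤ odds a
0≤odds {a} 0≤a a<1 with (1ℚ - a) ℚ.≟ 0ℚ
... | yes _ = ℚ.≤-refl
... | no 1-a≢0 = 0≤* 0≤a (ℚ.<⇒≤ (ℚ.positive⁻¹ _ {{ℚ.1/pos⇒pos (1ℚ - a) {{ℚ.positive (0<1-a a<1)}}}}))
  where instance _ = ℚ.≢-nonZero 1-a≢0

odds-when : ∀ {A : Set} (A? : Dec A) q → odds (when A? q) ≡ when A? (odds q)
odds-when (yes _) q = refl
odds-when (no _) q = refl

0≤∏ : ∀ k {f : Fin k → ℚ} → (∀ i → 0ℚ ≤ f i) → 0ℚ ≤ ∏ k f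
0≤∏ zero _ = ℚ.nonNegative⁻¹ 1ℚ
0≤∏ (suc k) 0≤f = 0≤* (0≤f zero) (0≤∏ k (λ i → 0≤f (suc i)))

∏≤1 : ∀ k {f : Fin k → ℚ} → (∀ i → 0ℚ ≤ f i) → (∀ i → f i ≤ 1ℚ) → ∏ k f ≤ 1ℚ
∏≤1 zero _ _ = ℚ.≤-refl
∏≤1 (suc k) {f} 0≤f f≤1 = subst (∏ (suc k) f ≤_) (ℚ.*-identityˡ 1ℚ)
  (*-mono-≤-nonNeg (ℚ.nonNegative⁻¹ 1ℚ) (0≤∏ k (λ i → 0≤f (suc i))) (f≤1 zero) (∏≤1 k (λ i → 0≤f (suc i)) (λ i → f≤1 (suc i))))

-- By induction on k: with P = ∏ (1 - aᵢ) and S = ∑ odds aᵢ over the tail,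
-- (1 - a₀) P (odds a₀ + S) = a₀ P + (1 - a₀) (P S) ≤ a₀ + (1 - a₀) = 1.
∏[1-a]*∑odds≤1 : ∀ k (a : Fin k → ℚ) → (∀ i → 0ℚ ≤ a i) → (∀ i → a i < 1ℚ) →
  ∏ k (λ i → 1ℚ - a i) ℚ.* ∑ k (λ i → odds (a i)) ≤ 1ℚ
∏[1-a]*∑odds≤1 zero _ _ _ = ℚ.nonNegative⁻¹ 1ℚ
∏[1-a]*∑odds≤1 (suc k) a 0≤a a<1 = begin
  (1ℚ - a₀) ℚ.* P ℚ.* (odds a₀ ℚ.+ S)  ≡⟨ distrib (1ℚ - a₀) P (odds a₀) S ⟩
  P ℚ.* ((1ℚ - a₀) ℚ.* odds a₀) ℚ.+ (1ℚ - a₀) ℚ.* (P ℚ.* S)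
    ≡⟨ cong (λ z → P ℚ.* z ℚ.+ (1ℚ - a₀) ℚ.* (P ℚ.* S)) ([1-a]*odds≡a (a<1 zero)) ⟩
  P ℚ.* a₀ ℚ.+ (1ℚ - a₀) ℚ.* (P ℚ.* S)
    ≤⟨ ℚ.+-mono-≤ (ℚ.*-monoʳ-≤-nonNeg a₀ {{ℚ.nonNegative (0≤a zero)}} P≤1)
                  (ℚ.*-monoˡ-≤-nonNeg (1ℚ - a₀) {{ℚ.nonNegative 0≤1-a₀}} PS≤1) ⟩
  1ℚ ℚ.* a₀ ℚ.+ (1ℚ - a₀) ℚ.* 1ℚ       ≡⟨ solve 1 (λ a → con 1ℚ :* a :+ (con 1ℚ :- a) :* con 1ℚ := con 1ℚ) refl a₀ ⟩
  1ℚ                                   ∎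
  where
  open ℚ.≤-Reasoning
  a₀ = a zero
  P = ∏ k (λ i → 1ℚ - a (suc i))
  S = ∑ k (λ i → odds (a (suc i)))
  0≤1-a : ∀ i → 0ℚ ≤ 1ℚ - a i
  0≤1-a i = ℚ.<⇒≤ (0<1-a (a<1 i))
  0≤1-a₀ = 0≤1-a zero
  P≤1 : P ≤ 1ℚ
  P≤1 = ∏≤1 k (λ i → 0≤1-a (suc i)) (λ i → 1-a≤1 (0≤a (suc i)))
  PS≤1 : P ℚ.* S ≤ 1ℚ
  PS≤1 = ∏[1-a]*∑odds≤1 k (λ i → a (suc i)) (λ i → 0≤a (suc i)) (λ i → a<1 (suc i))
  distrib : ∀ b P o S → b ℚ.* P ℚ.* (o ℚ.+ S) ≡ P ℚ.* (b ℚ.* o) ℚ.+ b ℚ.* (P ℚ.* S)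
  distrib = solve 4 (λ b P o S → b :* P :* (o :+ S) := P :* (b :* o) :+ b :* (P :* S)) refl

module Residues (n : ℕ) .{{_ : NonZero n}} where

  open Scan n

  -- The difference of two remainders is a multiple of n of absolute value below n.
  %ℕ-unique : ∀ a r q → r ℕ.< n → a ≡ + r ℤ.+ q ℤ.* + n → a %ℕ n ≡ r
  %ℕ-unique a r q r<n a≡ = ℤ.+-injective (ℤ.i-j≡0⇒i≡j _ _ (ℤ.∣i∣≡0⇒i≡0 ∣d∣≡0))
    where
    r′ = a %ℕ n
    q′ = a /ℕ n
    d≡ : + r′ ℤ.- + r ≡ (q ℤ.- q′) ℤ.* + n
    d≡ = begin
      + r′ ℤ.- + r                                    ≡⟨ shift (+ r′) (+ r) q′ (+ n) ⟩
      (+ r′ ℤ.+ q′ ℤ.* + n) ℤ.- (+ r ℤ.+ q′ ℤ.* + n)  ≡⟨ cong (ℤ._- (+ r ℤ.+ q′ ℤ.* + n)) (trans (sym (a≡a%ℕn+[a/ℕn]*n a n)) a≡) ⟩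
      (+ r ℤ.+ q ℤ.* + n) ℤ.- (+ r ℤ.+ q′ ℤ.* + n)    ≡⟨ collect (+ r) q q′ (+ n) ⟩
      (q ℤ.- q′) ℤ.* + n                              ∎
      where
      open ≡-Reasoning
      shift : ∀ (x y q′ N : ℤ) → x ℤ.- y ≡ (x ℤ.+ q′ ℤ.* N) ℤ.- (y ℤ.+ q′ ℤ.* N)
      shift = ℤ.solve-∀
      collect : ∀ (y q q′ N : ℤ) → (y ℤ.+ q ℤ.* N) ℤ.- (y ℤ.+ q′ ℤ.* N) ≡ (q ℤ.- q′) ℤ.* N
      collect = ℤ.solve-∀
    ∣d∣<n : ℤ.∣ + r′ ℤ.- + r ∣ ℕ.< n
    ∣d∣<n = ℕ.≤-<-trans (ℕ.≤-reflexive (cong ℤ.∣_∣ (ℤ.m-n≡m⊖n r′ r)))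
              (ℕ.≤-<-trans (ℤ.∣m⊝n∣≤m⊔n r′ r) (ℕ.⊔-lub (n%ℕd<d a n) r<n))
    ∣d∣≡∣Δq∣*n : ℤ.∣ + r′ ℤ.- + r ∣ ≡ ℤ.∣ q ℤ.- q′ ∣ * n
    ∣d∣≡∣Δq∣*n = trans (cong ℤ.∣_∣ d≡) (ℤ.∣i*j∣≡∣i∣*∣j∣ (q ℤ.- q′) (+ n))
    ∣d∣≡0 : ℤ.∣ + r′ ℤ.- + r ∣ ≡ 0
    ∣d∣≡0 with ℤ.∣ q ℤ.- q′ ∣ | ∣d∣≡∣Δq∣*n
    ... | zero | ∣d∣≡0 = ∣d∣≡0
    ... | suc k | ∣d∣≡n+k*n =
      ⊥-elim (ℕ.<-irrefl refl (ℕ.<-≤-trans ∣d∣<n (ℕ.≤-trans (ℕ.m≤m+n n (k * n)) (ℕ.≤-reflexive (sym ∣d∣≡n+k*n)))))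

  lag : Fin n → ℤ → ℕ
  lag v t = (t ℤ.- + toℕ v) %ℕ n

  private
    [t-l]+l≡t : ∀ t l → (t ℤ.- l) ℤ.+ l ≡ t
    [t-l]+l≡t = ℤ.solve-∀

  UpdTime≤ : ∀ v t → UpdTime v t ℤ.≤ t
  UpdTime≤ v t = ℤ.i-j≤i t (+ lag v t)

  <UpdTime+n : ∀ v t → t ℤ.< UpdTime v t ℤ.+ + n
  <UpdTime+n v t = subst (ℤ._< UpdTime v t ℤ.+ + n) ([t-l]+l≡t t (+ lag v t))
    (ℤ.+-monoʳ-< (UpdTime v t) (ℤ.+<+ (n%ℕd<d (t ℤ.- + toℕ v) n)))

  UpdTime-scanned : ∀ v t → IsScanned v (UpdTime v t)
  UpdTime-scanned v t = sym (%ℕ-unique (UpdTime v t) (toℕ v) q (Fin.toℕ<n v) (begin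
    t ℤ.- + lag v t                                        ≡⟨ rearrange t (+ toℕ v) (+ lag v t) ⟩
    + toℕ v ℤ.+ ((t ℤ.- + toℕ v) ℤ.- + lag v t)            ≡⟨ cong (λ z → + toℕ v ℤ.+ (z ℤ.- + lag v t)) (a≡a%ℕn+[a/ℕn]*n (t ℤ.- + toℕ v) n) ⟩
    + toℕ v ℤ.+ ((+ lag v t ℤ.+ q ℤ.* + n) ℤ.- + lag v t)  ≡⟨ cong (λ z → + toℕ v ℤ.+ z) (cancel (+ lag v t) (q ℤ.* + n)) ⟩
    + toℕ v ℤ.+ q ℤ.* + n                                  ∎))
    where
    open ≡-Reasoning
    q = (t ℤ.- + toℕ v) /ℕ n
    rearrange : ∀ (t v l : ℤ) → t ℤ.- l ≡ v ℤ.+ ((t ℤ.- v) ℤ.- l)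
    rearrange = ℤ.solve-∀
    cancel : ∀ (l m : ℤ) → (l ℤ.+ m) ℤ.- l ≡ m
    cancel = ℤ.solve-∀

  UpdTime-injective : ∀ {v v′ t t′} → UpdTime v t ≡ UpdTime v′ t′ → v ≡ v′
  UpdTime-injective {v} {v′} {t} {t′} eq =
    Fin.toℕ-injective (trans (UpdTime-scanned v t) (trans (cong (_%ℕ n) eq) (sym (UpdTime-scanned v′ t′))))

  UpdTime-unique : ∀ {v s t} → IsScanned v s → s ℤ.≤ t → t ℤ.< s ℤ.+ + n → UpdTime v t ≡ s
  UpdTime-unique {v} {s} {t} v≡s%n s≤t t<s+n = begin
    t ℤ.- + lag v t  ≡⟨ cong (λ l → t ℤ.- + l) lag≡k ⟩
    t ℤ.- + k        ≡⟨ cong (λ z → t ℤ.- z) +k≡t-s ⟩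
    t ℤ.- (t ℤ.- s)  ≡⟨ t-[t-s]≡s t s ⟩
    s                ∎
    where
    open ≡-Reasoning
    t-[t-s]≡s : ∀ (t s : ℤ) → t ℤ.- (t ℤ.- s) ≡ s
    t-[t-s]≡s = ℤ.solve-∀
    [s+N]-s≡N : ∀ (s N : ℤ) → s ℤ.+ N ℤ.- s ≡ N
    [s+N]-s≡N = ℤ.solve-∀
    k = ℤ.∣ s ℤ.- t ∣
    q = s /ℕ n
    +k≡t-s : + k ≡ t ℤ.- s
    +k≡t-s = ℤ.∣-∣-≤ s≤t
    k<n : k ℕ.< n
    k<n = ℤ.drop‿+<+ (subst (ℤ._< + n) (sym +k≡t-s)
            (subst (λ z → t ℤ.- s ℤ.< z) ([s+N]-s≡N s (+ n)) (ℤ.+-monoˡ-< (ℤ.- s) t<s+n)))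
    s≡v+qn : s ≡ + toℕ v ℤ.+ q ℤ.* + n
    s≡v+qn = trans (a≡a%ℕn+[a/ℕn]*n s n) (cong (λ r → + r ℤ.+ q ℤ.* + n) (sym v≡s%n))
    lag≡k : lag v t ≡ k
    lag≡k = %ℕ-unique (t ℤ.- + toℕ v) k q k<n (begin
      t ℤ.- + toℕ v                                  ≡⟨ split t s (+ toℕ v) ⟩
      (t ℤ.- s) ℤ.+ (s ℤ.- + toℕ v)                  ≡⟨ cong₂ (λ a b → a ℤ.+ (b ℤ.- + toℕ v)) (sym +k≡t-s) s≡v+qn ⟩
      + k ℤ.+ ((+ toℕ v ℤ.+ q ℤ.* + n) ℤ.- + toℕ v)  ≡⟨ cong (λ z → + k ℤ.+ z) (cancel (+ toℕ v) (q ℤ.* + n)) ⟩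
      + k ℤ.+ q ℤ.* + n                              ∎)
      where
      split : ∀ (t s v : ℤ) → t ℤ.- v ≡ (t ℤ.- s) ℤ.+ (s ℤ.- v)
      split = ℤ.solve-∀
      cancel : ∀ (v m : ℤ) → (v ℤ.+ m) ℤ.- v ≡ m
      cancel = ℤ.solve-∀

members : ∀ {n} → Subset n → List (Fin n)
members [] = []
members (true ∷ p) = zero ∷ map suc (members p)
members (false ∷ p) = map suc (members p)

length-members : ∀ {n} (p : Subset n) → length (members p) ≡ ∣ p ∣
length-members [] = refl
length-members (true ∷ p) = cong suc (trans (length-map suc (members p)) (length-members p))
length-members (false ∷ p) = trans (length-map suc (members p)) (length-members p)

∈-members : ∀ {n} (p : Subset n) {v} → v ∈ members p → v ∈ₛ p
∈-members (true ∷ p) (here refl) = Vec.here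
∈-members (true ∷ p) (there v∈) with ∈-map⁻ suc v∈
... | w , w∈ , refl = Vec.there (∈-members p w∈)
∈-members (false ∷ p) v∈ with ∈-map⁻ suc v∈
... | w , w∈ , refl = Vec.there (∈-members p w∈)

members-unique : ∀ {n} (p : Subset n) → Unique (members p)
members-unique [] = []
members-unique (true ∷ p) = ∷-unique zero∉ (Unique.map⁺ Fin.suc-injective (members-unique p))
  where
  zero∉ : zero ∈ map suc (members p) → ⊥
  zero∉ z∈ with ∈-map⁻ suc z∈
  ... | _ , _ , ()
members-unique (false ∷ p) = Unique.map⁺ Fin.suc-injective (members-unique p)

module Weights {n : ℕ} (Φ : Hypergraph n) where

  κ : Fin (m Φ) → ℚ
  κ c = fromℕ (2 * ∣ edge Φ c ∣) ℚ.* ½ ^ℚ ∣ edge Φ c ∣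

  0≤κ : ∀ c → 0ℚ ≤ κ c
  0≤κ c = 0≤* (0≤fromℕ (2 * ∣ edge Φ c ∣)) (0≤½^ ∣ edge Φ c ∣)

  weight : ℕ → Fin (m Φ) → ℚ
  weight zero _ = 1ℚ
  weight (suc j) c = ∑ (m Φ) λ c′ → when (Γ⁺? Φ c c′) (κ c′ ℚ.* weight j c′)

  0≤weight : ∀ j c → 0ℚ ≤ weight j c
  0≤weight zero _ = ℚ.nonNegative⁻¹ 1ℚ
  0≤weight (suc j) c = 0≤∑ (m Φ) λ c′ → 0≤when (Γ⁺? Φ c c′) (0≤* (0≤κ c′) (0≤weight j c′))

  *-weight-suc : ∀ j c h → h ℚ.* weight (suc j) c ≡ ∑ (m Φ) λ c′ → when (Γ⁺? Φ c c′) (h ℚ.* (κ c′ ℚ.* weight j c′))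
  *-weight-suc j c h = trans (∑-*ˡ (m Φ) h _) (∑-cong (m Φ) λ c′ → *-when (Γ⁺? Φ c c′) h _)

  -- The union bound over the 2|c| choices (v, b) of a step produces exactly κ c.
  choices≡ : ∀ j c h →
    fromℕ ∣ edge Φ c ∣ ℚ.* (fromℕ 2 ℚ.* (h ℚ.* ½ ^ℚ ∣ edge Φ c ∣ ℚ.* weight j c)) ≡ h ℚ.* (κ c ℚ.* weight j c)
  choices≡ j c h = begin
    fromℕ k ℚ.* (fromℕ 2 ℚ.* (h ℚ.* ½ ^ℚ k ℚ.* w))  ≡⟨ reorder (fromℕ k) (fromℕ 2) h (½ ^ℚ k) w ⟩
    h ℚ.* (fromℕ 2 ℚ.* fromℕ k ℚ.* ½ ^ℚ k ℚ.* w)    ≡⟨ cong (λ z → h ℚ.* (z ℚ.* ½ ^ℚ k ℚ.* w)) (sym (fromℕ-* 2 k)) ⟩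
    h ℚ.* (κ c ℚ.* w)                               ∎
    where
    open ≡-Reasoning
    k = ∣ edge Φ c ∣
    w = weight j c
    reorder : ∀ a t h g w → a ℚ.* (t ℚ.* (h ℚ.* g ℚ.* w)) ≡ h ℚ.* (t ℚ.* a ℚ.* g ℚ.* w)
    reorder = solve 5 (λ a t h g w → a :* (t :* (h :* g :* w)) := h :* (t :* a :* g :* w)) refl

module Witnesses {n : ℕ} .{{_ : NonZero n}} (Φ : Hypergraph n) (T : ℕ) where

  open Scan n
  open Residues n
  open Witness Φ T
  open Weights Φ

  W : ℕ
  W = T + n

  timesOf : Fin (m Φ) → ℤ → List ℤ
  timesOf c t = map (λ v → UpdTime v t) (members (edge Φ c))

  length-timesOf : ∀ c t → length (timesOf c t) ≡ ∣ edge Φ c ∣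
  length-timesOf c t = trans (length-map _ (members (edge Φ c))) (length-members (edge Φ c))

  ∈-timesOf : ∀ {c t u} → u ∈ timesOf c t → u ∈e[ c , t ]
  ∈-timesOf {c} {t} u∈ with ∈-map⁻ (λ v → UpdTime v t) u∈
  ... | v , v∈ , refl = v , ∈-members (edge Φ c) v∈ , refl

  timesOf-unique : ∀ c t → Unique (timesOf c t)
  timesOf-unique c t = Unique.map⁺ (UpdTime-injective {t = t} {t′ = t}) (members-unique (edge Φ c))

  ∈e-bounds : ∀ {u c t} → u ∈e[ c , t ] → u ℤ.≤ t × t ℤ.< u ℤ.+ + n
  ∈e-bounds {t = t} (v , _ , refl) = UpdTime≤ v t , <UpdTime+n v t

  Intersect⇒Meets : ∀ {c t c′ t′} → Intersect c t c′ t′ → Meets Φ c c′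
  Intersect⇒Meets {t = t} {c′} {t′} (_ , (v , v∈ , refl) , (v′ , v′∈ , eq)) =
    v , x∈p∩q⁺ (v∈ , subst (_∈ₛ edge Φ c′) (UpdTime-injective {t = t′} {t′ = t} eq) v′∈)

  -- Time u is stored at index u + n - 1 of an outcome vector (see bits).
  InWindow : ℤ → Set
  InWindow u = Σ (Fin W) λ p → u ℤ.+ + (n ∸ 1) ≡ + toℕ p

  bits-lookup : ∀ (ω : Vec Bool W) {u} p → u ℤ.+ + (n ∸ 1) ≡ + toℕ p → bits {n} ω u ≡ lookup ω p
  bits-lookup ω {u} p eq with u ℤ.+ + (n ∸ 1)
  bits-lookup ω p refl | .(+ toℕ p) with toℕ p ℕ.<? W
  ... | yes p<W = cong (lookup ω) (Fin.fromℕ<-toℕ p p<W)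
  ... | no p≮W = ⊥-elim (p≮W (Fin.toℕ<n p))

  inWindow : ∀ {u c t} → + 1 ℤ.≤ t → t ℤ.≤ + T → u ∈e[ c , t ] → InWindow u
  inWindow {u} {t = t} 1≤t t≤T u∈ = fromℕ< k<W , trans (sym +k≡) (cong +_ (sym (Fin.toℕ-fromℕ< k<W)))
    where
    u≤t = proj₁ (∈e-bounds u∈)
    t<u+n = proj₂ (∈e-bounds u∈)
    pred[u+n]≡ : ℤ.pred (u ℤ.+ + n) ≡ u ℤ.+ + (n ∸ 1)
    pred[u+n]≡ = trans (cong (λ k → ℤ.pred (u ℤ.+ + k)) (sym (ℕ.m+[n∸m]≡n {1} {n} (ℕ.>-nonZero⁻¹ n))))
                   (cancel u (+ (n ∸ 1)))
      where
      cancel : ∀ (u k : ℤ) → ℤ.- + 1 ℤ.+ (u ℤ.+ (+ 1 ℤ.+ k)) ≡ u ℤ.+ k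
      cancel = ℤ.solve-∀
    +k≡ : + ℤ.∣ u ℤ.+ + (n ∸ 1) ∣ ≡ u ℤ.+ + (n ∸ 1)
    +k≡ = ℤ.0≤i⇒+∣i∣≡i (ℤ.≤-trans (ℤ.+≤+ ℕ.z≤n) (ℤ.≤-trans 1≤t
            (subst (t ℤ.≤_) pred[u+n]≡ (ℤ.i<j⇒i≤pred[j] t<u+n))))
    k<W : ℤ.∣ u ℤ.+ + (n ∸ 1) ∣ ℕ.< W
    k<W = ℕ.≤-<-trans (ℤ.drop‿+≤+ (subst (ℤ._≤ + (T + (n ∸ 1))) (sym +k≡)
            (subst (u ℤ.+ + (n ∸ 1) ℤ.≤_) (sym (ℤ.pos-+ T (n ∸ 1))) (ℤ.+-monoˡ-≤ (+ (n ∸ 1)) (ℤ.≤-trans u≤t t≤T)))))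
            (ℕ.+-monoʳ-< T (ℕ.∸-monoʳ-< (ℕ.s≤s ℕ.z≤n) (ℕ.>-nonZero⁻¹ n)))

  positions : ∀ {U} → All InWindow U → List (Fin W)
  positions [] = []
  positions ((p , _) ∷ ws) = p ∷ positions ws

  length-positions : ∀ {U} (ws : All InWindow U) → length (positions ws) ≡ length U
  length-positions [] = refl
  length-positions (_ ∷ ws) = cong suc (length-positions ws)

  ∈-positions : ∀ {U} (ws : All InWindow U) {p} → p ∈ positions ws →
    Σ ℤ λ u → u ∈ U × u ℤ.+ + (n ∸ 1) ≡ + toℕ p
  ∈-positions ((_ , eq) ∷ ws) (here refl) = _ , here refl , eq
  ∈-positions (_ ∷ ws) (there p∈) with ∈-positions ws p∈
  ... | u , u∈ , eq = u , there u∈ , eq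

  positions-unique : ∀ {U} (ws : All InWindow U) → Unique U → Unique (positions ws)
  positions-unique [] _ = []
  positions-unique {_ ∷ U} ((p , eq) ∷ ws) uU@(_ ∷ uU′) = ∷-unique p∉ (positions-unique ws uU′)
    where
    p∉ : p ∈ positions ws → ⊥
    p∉ p∈ with ∈-positions ws p∈
    ... | u′ , u′∈ , eq′ = Unique.Unique[x∷xs]⇒x∉xs uU (subst (_∈ U) (+-cancelʳ (trans eq′ (sym eq))) u′∈)
      where
      +-cancelʳ : ∀ {a b c} → a ℤ.+ c ≡ b ℤ.+ c → a ≡ b
      +-cancelʳ {a} {b} {c} eq = trans (undo a c) (trans (cong (ℤ._- c) eq) (sym (undo b c)))
        where
        undo : ∀ (a c : ℤ) → a ≡ (a ℤ.+ c) ℤ.- c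
        undo = ℤ.solve-∀

  TrueOn : List ℤ → Vec Bool W → Set
  TrueOn U ω = All (λ u → bits {n} ω u ≡ true) U

  TrueOn⇒TrueAt : ∀ {U} (ws : All InWindow U) {ω} → TrueOn U ω → TrueAt (positions ws) ω
  TrueOn⇒TrueAt [] [] = []
  TrueOn⇒TrueAt {u ∷ _} ((p , eq) ∷ ws) {ω} (b≡true ∷ bs) = trans (sym (bits-lookup ω {u} p eq)) b≡true ∷ TrueOn⇒TrueAt ws bs

  PrAtMost-TrueOn : ∀ {U} → Unique U → All InWindow U → PrAtMost W (TrueOn U) (½ ^ℚ length U)
  PrAtMost-TrueOn {U} uU ws = PrAtMost-mono {P = TrueAt (positions ws)} (TrueOn⇒TrueAt ws)
    (ℚ.≤-reflexive (cong (½ ^ℚ_) (length-positions ws)))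
    (PrAtMost-TrueAt (positions ws) (positions-unique ws uU))

  Admissible : List ℤ → Set
  Admissible U = Unique U × All InWindow U

  earlier : Fin 2 → ℤ → ℤ
  earlier zero t = ℤ.pred t
  earlier (suc zero) t = ℤ.pred t ℤ.- + n

  -- The vertices e₁, e₃, e₅, … of an induced path: each step is fixed by one of
  -- the 2|c′| choices (v, b), and U collects the time points of all of them.
  Chain : ℕ → Fin (m Φ) → ℤ → List ℤ → Vec Bool W → Set
  Chain zero c t U ω = TrueOn U ω
  Chain (suc j) c t U ω =
    Σ (Fin (m Φ)) λ c′ → Γ⁺ Φ c c′ ×
    Σ (Fin n) λ v → v ∈ₛ edge Φ c′ ×
    Σ (Fin 2) λ b → Admissible (U ++ timesOf c′ (UpdTime v (earlier b t)))
      × Chain j c′ (UpdTime v (earlier b t)) (U ++ timesOf c′ (UpdTime v (earlier b t))) ω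

  PrAtMost-Chain : ∀ j c t U → Admissible U → PrAtMost W (Chain j c t U) (½ ^ℚ length U ℚ.* weight j c)
  PrAtMost-Chain zero _ _ U (uU , wU) =
    PrAtMost-≤ (ℚ.≤-reflexive (sym (ℚ.*-identityʳ (½ ^ℚ length U)))) (PrAtMost-TrueOn uU wU)
  PrAtMost-Chain (suc j) c t U _ =
    PrAtMost-≤ (ℚ.≤-reflexive (sym (*-weight-suc j c h)))
      (PrAtMost-Σ (m Φ) λ c′ → PrAtMost-when (Γ⁺? Φ c c′) λ _ →
        PrAtMost-≤ (ℚ.≤-reflexive (choices≡ j c′ h))
          (PrAtMost-Σ∈ (edge Φ c′) {p = fromℕ 2 ℚ.* p c′} (0≤* (0≤fromℕ 2) (0≤p c′)) λ v _ →
            PrAtMost-Σ-uniform 2 {p = p c′} λ b →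
              let t′ = UpdTime v (earlier b t) in
              PrAtMost-× (λ adm → PrAtMost-≤ (ℚ.≤-reflexive (length≡ c′ t′)) (PrAtMost-Chain j c′ t′ (U ++ timesOf c′ t′) adm))
                (0≤p c′)))
    where
    h = ½ ^ℚ length U
    p : Fin (m Φ) → ℚ
    p c′ = h ℚ.* ½ ^ℚ ∣ edge Φ c′ ∣ ℚ.* weight j c′
    0≤p : ∀ c′ → 0ℚ ≤ p c′
    0≤p c′ = 0≤* (0≤* (0≤½^ (length U)) (0≤½^ ∣ edge Φ c′ ∣)) (0≤weight j c′)
    length≡ : ∀ c′ t′ → ½ ^ℚ length (U ++ timesOf c′ t′) ℚ.* weight j c′ ≡ p c′
    length≡ c′ t′ = begin
      ½ ^ℚ length (U ++ timesOf c′ t′) ℚ.* weight j c′  ≡⟨ cong (λ l → ½ ^ℚ l ℚ.* weight j c′) (length-++ U) ⟩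
      ½ ^ℚ (length U + length (timesOf c′ t′)) ℚ.* weight j c′
        ≡⟨ cong (λ l → ½ ^ℚ (length U + l) ℚ.* weight j c′) (length-timesOf c′ t′) ⟩
      ½ ^ℚ (length U + ∣ edge Φ c′ ∣) ℚ.* weight j c′   ≡⟨ cong (ℚ._* weight j c′) (^ℚ-+ ½ (length U) ∣ edge Φ c′ ∣) ⟩
      p c′                                              ∎
      where open ≡-Reasoning

  ChainFromT : ℕ → Vec Bool W → Set
  ChainFromT K ω = Σ (Fin (m Φ)) λ c → Σ (Fin n) λ v → v ∈ₛ edge Φ c ×
    Admissible (timesOf c (UpdTime v (+ T))) × Chain K c (UpdTime v (+ T)) (timesOf c (UpdTime v (+ T))) ω

  PrAtMost-ChainFromT : ∀ K → PrAtMost W (ChainFromT K) (∑ (m Φ) λ c → fromℕ ∣ edge Φ c ∣ ℚ.* (½ ^ℚ ∣ edge Φ c ∣ ℚ.* weight K c))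
  PrAtMost-ChainFromT K = PrAtMost-Σ (m Φ) λ c →
    PrAtMost-Σ∈ (edge Φ c) (0≤* (0≤½^ ∣ edge Φ c ∣) (0≤weight K c)) λ v _ →
      let t = UpdTime v (+ T) in
      PrAtMost-× (λ adm → PrAtMost-≤ (ℚ.≤-reflexive (cong (λ k → ½ ^ℚ k ℚ.* weight K c) (length-timesOf c t)))
                             (PrAtMost-Chain K c t (timesOf c t) adm))
        (0≤* (0≤½^ ∣ edge Φ c ∣) (0≤weight K c))

  private
    [a+k]-k≡a : ∀ (a k : ℤ) → (a ℤ.+ k) ℤ.- k ≡ a
    [a+k]-k≡a = ℤ.solve-∀

  pred[t]<t : ∀ t → ℤ.pred t ℤ.< t
  pred[t]<t t = ℤ.i≤pred[j]⇒i<j ℤ.≤-refl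

  span<2n : ∀ {c t c′ t′ c″ t″} → Edge c t c′ t′ → Edge c′ t′ c″ t″ → t ℤ.< t″ ℤ.+ + n ℤ.+ + n
  span<2n {c} {t} {c′} {t′} {c″} {t″} (_ , u₁ , u₁∈ , u₁∈′) (_ , u₂ , u₂∈′ , u₂∈″) = begin-strict
    t                   <⟨ proj₂ (∈e-bounds {c = c} {t} u₁∈) ⟩
    u₁ ℤ.+ + n          ≤⟨ ℤ.+-monoˡ-≤ (+ n) (proj₁ (∈e-bounds {c = c′} {t′} u₁∈′)) ⟩
    t′ ℤ.+ + n          <⟨ ℤ.+-monoˡ-< (+ n) (proj₂ (∈e-bounds {c = c′} {t′} u₂∈′)) ⟩
    u₂ ℤ.+ + n ℤ.+ + n  ≤⟨ ℤ.+-monoˡ-≤ (+ n) (ℤ.+-monoˡ-≤ (+ n) (proj₁ (∈e-bounds {c = c″} {t″} u₂∈″))) ⟩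
    t″ ℤ.+ + n ℤ.+ + n  ∎
    where open ℤ.≤-Reasoning

  -- Two consecutive edges span less than 2n time steps, so the time of the
  -- third vertex is the last scan of its vertex v within n steps before t
  -- (b = 0) or within the n steps before that (b = 1).
  twoSteps : ∀ {c t c′ t′ c″ t″ v} → Edge c t c′ t′ → Edge c′ t′ c″ t″ → IsScanned v t″ →
    Σ (Fin 2) λ b → UpdTime v (earlier b t) ≡ t″
  twoSteps {t = t} {t″ = t″} e₁@(t′<t , _) e₂@(t″<t′ , _) scanned with t ℤ.≤? t″ ℤ.+ + n
  ... | yes t≤t″+n = zero , UpdTime-unique scanned (ℤ.i<j⇒i≤pred[j] (ℤ.<-trans t″<t′ t′<t)) (ℤ.<-≤-trans (pred[t]<t t) t≤t″+n)
  ... | no t≰t″+n = suc zero , UpdTime-unique scanned t″≤pred[t]-n pred[t]-n<t″+n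
    where
    t″≤pred[t]-n = subst (ℤ._≤ ℤ.pred t ℤ.- + n) ([a+k]-k≡a t″ (+ n))
      (ℤ.+-monoˡ-≤ (ℤ.- + n) (ℤ.i<j⇒i≤pred[j] (ℤ.≰⇒> t≰t″+n)))
    pred[t]-n<t″+n = subst (ℤ.pred t ℤ.- + n ℤ.<_) ([a+k]-k≡a (t″ ℤ.+ + n) (+ n))
      (ℤ.+-monoˡ-< (ℤ.- + n) (ℤ.<-trans (pred[t]<t t) (span<2n e₁ e₂)))

  module Path {L : ℕ} {cs : Fin L → Fin (m Φ)} {ts : Fin L → ℤ} (P : InducedPath L cs ts) where

    open InducedPath P

    next : (i : Fin L) → suc (toℕ i) ℕ.< L → Σ (Fin L) λ j → suc (toℕ i) ≡ toℕ j
    next i i+1<L = fromℕ< i+1<L , sym (Fin.toℕ-fromℕ< i+1<L)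

    ts-decreasing : ∀ d i j → toℕ j ≡ suc (d + toℕ i) → ts j ℤ.< ts i
    ts-decreasing zero i j j≡i+1 = proj₁ (edges i j (sym j≡i+1))
    ts-decreasing (suc d) i j j≡ with next i i+1<L
      where
      i+1<L = ℕ.<-≤-trans (ℕ.s≤s (ℕ.s≤s (ℕ.m≤n+m (toℕ i) d))) (ℕ.≤-trans (ℕ.≤-reflexive (sym j≡)) (ℕ.<⇒≤ (Fin.toℕ<n j)))
    ... | k , k≡i+1 = ℤ.<-trans (ts-decreasing d k j j≡k+d+1) (proj₁ (edges i k k≡i+1))
      where
      j≡k+d+1 : toℕ j ≡ suc (d + toℕ k)
      j≡k+d+1 = trans j≡ (cong suc (trans (sym (ℕ.+-suc d (toℕ i))) (cong (λ z → d + z) k≡i+1)))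

    -- Times decrease along the path, so a shared time point would be an edge,
    -- which an induced path does not have between vertices at distance ≥ 2.
    nonadjacent-disjoint : ∀ q j → 2 + toℕ q ℕ.≤ toℕ j → ∀ {u} → u ∈e[ cs q , ts q ] → u ∈e[ cs j , ts j ] → ⊥
    nonadjacent-disjoint q j q+2≤j {u} u∈q u∈j =
      ℕ.<-irrefl refl (subst (2 + toℕ q ℕ.≤_) (sym (induced q j (ts-decreasing d q j j≡ , u , u∈q , u∈j))) q+2≤j)
      where
      d = toℕ j ℕ.∸ suc (toℕ q)
      j≡ : toℕ j ≡ suc (d + toℕ q)
      j≡ = sym (trans (cong suc (ℕ.+-comm d (toℕ q))) (ℕ.m+[n∸m]≡n {suc (toℕ q)} (ℕ.<⇒≤ q+2≤j)))

    twoAhead : ∀ i {K} → 2 + toℕ i + K ℕ.< L → Σ (Fin L) λ h → Σ (Fin L) λ j →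
      suc (toℕ i) ≡ toℕ h × suc (toℕ h) ≡ toℕ j × toℕ j + K ℕ.< L
    twoAhead i {K} i+2+K<L with next i (ℕ.<-trans (ℕ.n<1+n _) i+2<L)
      where i+2<L = ℕ.m+n≤o⇒m≤o (3 + toℕ i) i+2+K<L
    ... | h , i→h with next h (subst (λ z → suc z ℕ.< L) i→h (ℕ.m+n≤o⇒m≤o (3 + toℕ i) i+2+K<L))
    ... | j , h→j = h , j , i→h , h→j , subst (λ z → z + K ℕ.< L) (trans (cong suc i→h) h→j) i+2+K<L

    skip : ∀ {i h j} → suc (toℕ i) ≡ toℕ h → suc (toℕ h) ≡ toℕ j →
      Γ⁺ Φ (cs i) (cs j) × Σ (Fin n) λ v → v ∈ₛ edge Φ (cs j) × Σ (Fin 2) λ b → UpdTime v (earlier b (ts i)) ≡ ts j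
    skip {i} {h} {j} i→h h→j with edges i h i→h | edges h j h→j | vertices j
    ... | e₁ | e₂ | (_ , _ , v , v∈ , scanned) =
      inj₂ (cs h , Intersect⇒Meets {t = ts i} {t′ = ts h} (proj₂ e₁) , Intersect⇒Meets {t = ts h} {t′ = ts j} (proj₂ e₂)) ,
      v , v∈ , twoSteps e₁ e₂ scanned

    module _ {ω : Vec Bool W} (isOpen : ∀ i → Open (bits {n} ω) (cs i) (ts i)) where

      Visited : Fin L → List ℤ → Set
      Visited i U = ∀ {u} → u ∈ U → Σ (Fin L) λ q → toℕ q ℕ.≤ toℕ i × u ∈e[ cs q , ts q ]

      visited-admissible : ∀ {i U} → Unique U → Visited i U → Admissible U
      visited-admissible uU visited = uU , All.tabulate λ u∈ →
        let (q , _ , u∈q) = visited u∈ in inWindow {c = cs q} (proj₁ (vertices q)) (proj₁ (proj₂ (vertices q))) u∈q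

      visited-true : ∀ {i U} → Visited i U → TrueOn U ω
      visited-true visited = All.tabulate λ u∈ → let (q , _ , u∈q) = visited u∈ in isOpen q _ u∈q

      path⇒Chain : ∀ K i → toℕ i + 2 * K ℕ.< L → ∀ U → Unique U → Visited i U → Chain K (cs i) (ts i) U ω
      path⇒Chain zero i _ U _ visited = visited-true visited
      path⇒Chain (suc K) i bound U uU visited with twoAhead i bound′
        where
        bound′ : 2 + toℕ i + 2 * K ℕ.< L
        bound′ = subst (ℕ._< L) (shuffle (toℕ i) K) bound
          where
          shuffle : ∀ a k → a + 2 * suc k ≡ 2 + a + 2 * k
          shuffle = ℕ.solve-∀
      ... | h , j , i→h , h→j , bound″ with skip i→h h→j
      ... | Γ⁺ij , v , v∈ , b , t≡ =
        cs j , Γ⁺ij , v , v∈ , b ,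
        subst (λ τ → Admissible (U ++ timesOf (cs j) τ) × Chain K (cs j) τ (U ++ timesOf (cs j) τ) ω) (sym t≡)
          (visited-admissible uU′ visited′ , path⇒Chain K j bound″ U′ uU′ visited′)
        where
        j≡i+2 : toℕ j ≡ 2 + toℕ i
        j≡i+2 = sym (trans (cong suc i→h) h→j)
        U′ = U ++ timesOf (cs j) (ts j)
        uU′ : Unique U′
        uU′ = Unique.++⁺ uU (timesOf-unique (cs j) (ts j)) λ (u∈U , u∈j) →
          let (q , q≤i , u∈q) = visited u∈U in
          nonadjacent-disjoint q j (subst (2 + toℕ q ℕ.≤_) (sym j≡i+2) (ℕ.+-monoʳ-≤ 2 q≤i)) u∈q (∈-timesOf {cs j} {ts j} u∈j)
        visited′ : Visited j U′
        visited′ u∈ with ∈-++⁻ U u∈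
        ... | inj₁ u∈U = let (q , q≤i , u∈q) = visited u∈U in
          q , ℕ.≤-trans q≤i (subst (toℕ i ℕ.≤_) (sym j≡i+2) (ℕ.m≤n+m (toℕ i) 2)) , u∈q
        ... | inj₂ u∈j = j , ℕ.≤-refl , ∈-timesOf {cs j} {ts j} u∈j

  Event⇒ChainFromT : ∀ L K → 2 * K ℕ.< L → ∀ ω → Event L (bits {n} ω) → ChainFromT K ω
  Event⇒ChainFromT L K 2K<L ω (cs , ts , P , isOpen , i₀ , i₀≡0 , u , u∈ , T-n<u , _)
    with InducedPath.vertices P i₀
  ... | _ , t₀≤T , v , v∈ , scanned =
    cs i₀ , v , v∈ ,
    subst (λ τ → Admissible (timesOf (cs i₀) τ) × Chain K (cs i₀) τ (timesOf (cs i₀) τ) ω) (sym t₀≡)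
      (visited-admissible isOpen uU visited , path⇒Chain isOpen K i₀ bound U uU visited)
    where
    open Path P
    t₀ = ts i₀
    T<t₀+n : + T ℤ.< t₀ ℤ.+ + n
    T<t₀+n = begin-strict
      + T                    ≡⟨ sym ([a-k]+k≡a (+ T) (+ n)) ⟩
      (+ T ℤ.- + n) ℤ.+ + n  <⟨ ℤ.+-monoˡ-< (+ n) T-n<u ⟩
      u ℤ.+ + n              ≤⟨ ℤ.+-monoˡ-≤ (+ n) (proj₁ (∈e-bounds {c = cs i₀} {t₀} u∈)) ⟩
      t₀ ℤ.+ + n             ∎
      where
      open ℤ.≤-Reasoning
      [a-k]+k≡a : ∀ (a k : ℤ) → (a ℤ.- k) ℤ.+ k ≡ a
      [a-k]+k≡a = ℤ.solve-∀
    t₀≡ : UpdTime v (+ T) ≡ t₀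
    t₀≡ = UpdTime-unique scanned t₀≤T T<t₀+n
    U = timesOf (cs i₀) t₀
    uU = timesOf-unique (cs i₀) t₀
    visited : Visited isOpen i₀ U
    visited u∈U = i₀ , ℕ.≤-refl , ∈-timesOf {cs i₀} {t₀} u∈U
    bound : toℕ i₀ + 2 * K ℕ.< L
    bound = subst (λ z → z + 2 * K ℕ.< L) (sym i₀≡0) 2K<L

module WeightBound {n : ℕ} (Φ : Hypergraph n) (ε : ℚ) (x : Fin (m Φ) → ℚ)
  (0<ε<1 : 0ℚ < ε × ε < 1ℚ) (0<x<1 : ∀ c → 0ℚ < x c × x c < 1ℚ)
  (κ≤ : ∀ c → Weights.κ Φ c ≤ ((1ℚ - ε) ℚ.* x c) ℚ.* prodΓ Φ x c) where

  open Weights Φ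

  0≤x : ∀ c → 0ℚ ≤ x c
  0≤x c = ℚ.<⇒≤ (proj₁ (0<x<1 c))

  0≤1-ε : 0ℚ ≤ 1ℚ - ε
  0≤1-ε = ℚ.<⇒≤ (0<1-a (proj₂ 0<ε<1))

  Γ⁺-refl : ∀ c → Γ⁺ Φ c c
  Γ⁺-refl c = inj₁ (proj₁ (nonempty Φ c) , x∈p∩q⁺ (proj₂ (nonempty Φ c) , proj₂ (nonempty Φ c)))

  xΓ⁺ : Fin (m Φ) → Fin (m Φ) → ℚ
  xΓ⁺ c c′ = when (Γ⁺? Φ c c′) (x c′)

  ∏Γ⁺ : Fin (m Φ) → ℚ
  ∏Γ⁺ c = ∏ (m Φ) λ c′ → 1ℚ - xΓ⁺ c c′

  -- prodΓ multiplies factors defined in a where clause; this names them.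
  private
    prodΓ-factors : ∀ c → Σ (Fin (m Φ) → ℚ) λ f → prodΓ Φ x c ≡ ∏ (m Φ) f
    prodΓ-factors c = _ , refl

  factor : Fin (m Φ) → Fin (m Φ) → ℚ
  factor c = proj₁ (prodΓ-factors c)

  factor-self : ∀ c → factor c c ≡ 1ℚ
  factor-self c with Γ⁺? Φ c c | c Fin.≟ c
  ... | _ | no c≢c = ⊥-elim (c≢c refl)
  ... | yes _ | yes _ = refl
  ... | no _ | yes _ = refl

  factor-other : ∀ c c′ → c′ ≢ c → factor c c′ ≡ 1ℚ - xΓ⁺ c c′
  factor-other c c′ c′≢c with Γ⁺? Φ c c′ | c Fin.≟ c′
  ... | _ | yes refl = ⊥-elim (c′≢c refl)
  ... | yes _ | no _ = refl
  ... | no _ | no _ = refl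

  ∏Γ⁺≡ : ∀ c → (1ℚ - x c) ℚ.* prodΓ Φ x c ≡ ∏Γ⁺ c
  ∏Γ⁺≡ c = trans (cong (λ z → (1ℚ - z) ℚ.* prodΓ Φ x c) (sym xΓ⁺-self))
    (∏-update (m Φ) (factor c) (λ c′ → 1ℚ - xΓ⁺ c c′) c (factor-self c) (factor-other c))
    where
    xΓ⁺-self : xΓ⁺ c c ≡ x c
    xΓ⁺-self with Γ⁺? Φ c c
    ... | yes _ = refl
    ... | no ¬c~c = ⊥-elim (¬c~c (Γ⁺-refl c))

  0≤xΓ⁺ : ∀ c c′ → 0ℚ ≤ xΓ⁺ c c′
  0≤xΓ⁺ c c′ = 0≤when (Γ⁺? Φ c c′) (0≤x c′)

  xΓ⁺<1 : ∀ c c′ → xΓ⁺ c c′ < 1ℚ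
  xΓ⁺<1 c c′ with Γ⁺? Φ c c′
  ... | yes _ = proj₂ (0<x<1 c′)
  ... | no _ = ℚ.positive⁻¹ 1ℚ

  0≤∏Γ⁺ : ∀ c → 0ℚ ≤ ∏Γ⁺ c
  0≤∏Γ⁺ c = 0≤∏ (m Φ) λ c′ → ℚ.<⇒≤ (0<1-a (xΓ⁺<1 c c′))

  ∏Γ⁺*∑odds≤1 : ∀ c → ∏Γ⁺ c ℚ.* ∑ (m Φ) (λ c′ → when (Γ⁺? Φ c c′) (odds (x c′))) ≤ 1ℚ
  ∏Γ⁺*∑odds≤1 c = subst (λ s → ∏Γ⁺ c ℚ.* s ≤ 1ℚ) (∑-cong (m Φ) λ c′ → odds-when (Γ⁺? Φ c c′) (x c′))
    (∏[1-a]*∑odds≤1 (m Φ) (xΓ⁺ c) (0≤xΓ⁺ c) (xΓ⁺<1 c))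

  E : ℚ
  E = 1ℚ - ε

  κ*weight≤ : ∀ j → (∀ c → weight j c ℚ.* ∏Γ⁺ c ≤ E ^ℚ j) → ∀ c → κ c ℚ.* weight j c ≤ E ^ℚ suc j ℚ.* odds (x c)
  κ*weight≤ j weight*∏Γ⁺≤ c = begin
    κ c ℚ.* w                                                  ≤⟨ ℚ.*-monoʳ-≤-nonNeg w {{ℚ.nonNegative (0≤weight j c)}} (κ≤ c) ⟩
    E ℚ.* x c ℚ.* prodΓ Φ x c ℚ.* w                            ≡⟨ cong (λ z → E ℚ.* z ℚ.* prodΓ Φ x c ℚ.* w) (sym ([1-a]*odds≡a (proj₂ (0<x<1 c)))) ⟩
    E ℚ.* ((1ℚ - x c) ℚ.* odds (x c)) ℚ.* prodΓ Φ x c ℚ.* w    ≡⟨ reorder E (1ℚ - x c) (odds (x c)) (prodΓ Φ x c) w ⟩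
    E ℚ.* odds (x c) ℚ.* (w ℚ.* ((1ℚ - x c) ℚ.* prodΓ Φ x c))  ≡⟨ cong (λ z → E ℚ.* odds (x c) ℚ.* (w ℚ.* z)) (∏Γ⁺≡ c) ⟩
    E ℚ.* odds (x c) ℚ.* (w ℚ.* ∏Γ⁺ c)                         ≤⟨ ℚ.*-monoˡ-≤-nonNeg (E ℚ.* odds (x c)) {{ℚ.nonNegative 0≤E*odds}} (weight*∏Γ⁺≤ c) ⟩
    E ℚ.* odds (x c) ℚ.* E ^ℚ j                                ≡⟨ solve 3 (λ E o F → E :* o :* F := E :* F :* o) refl E (odds (x c)) (E ^ℚ j) ⟩
    E ^ℚ suc j ℚ.* odds (x c)                                  ∎
    where
    open ℚ.≤-Reasoning
    w = weight j c
    0≤E*odds : 0ℚ ≤ E ℚ.* odds (x c)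
    0≤E*odds = 0≤* 0≤1-ε (0≤odds (0≤x c) (proj₂ (0<x<1 c)))
    reorder : ∀ E u o p w → E ℚ.* (u ℚ.* o) ℚ.* p ℚ.* w ≡ E ℚ.* o ℚ.* (w ℚ.* (u ℚ.* p))
    reorder = solve 5 (λ E u o p w → E :* (u :* o) :* p :* w := E :* o :* (w :* (u :* p))) refl

  weight*∏Γ⁺≤ : ∀ j c → weight j c ℚ.* ∏Γ⁺ c ≤ E ^ℚ j
  weight*∏Γ⁺≤ zero c = subst (_≤ 1ℚ) (sym (ℚ.*-identityˡ (∏Γ⁺ c)))
    (∏≤1 (m Φ) (λ c′ → ℚ.<⇒≤ (0<1-a (xΓ⁺<1 c c′))) (λ c′ → 1-a≤1 (0≤xΓ⁺ c c′)))
  weight*∏Γ⁺≤ (suc j) c = begin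
    ∑ (m Φ) (λ c′ → when (Γ⁺? Φ c c′) (κ c′ ℚ.* weight j c′)) ℚ.* ∏Γ⁺ c
      ≤⟨ ℚ.*-monoʳ-≤-nonNeg (∏Γ⁺ c) {{ℚ.nonNegative (0≤∏Γ⁺ c)}}
           (∑-mono-≤ (m Φ) λ c′ → when-mono-≤ (Γ⁺? Φ c c′) (κ*weight≤ j (weight*∏Γ⁺≤ j) c′)) ⟩
    ∑ (m Φ) (λ c′ → when (Γ⁺? Φ c c′) (Eʲ⁺¹ ℚ.* odds (x c′))) ℚ.* ∏Γ⁺ c
      ≡⟨ cong (ℚ._* ∏Γ⁺ c) (sym (trans (∑-*ˡ (m Φ) Eʲ⁺¹ _) (∑-cong (m Φ) λ c′ → *-when (Γ⁺? Φ c c′) Eʲ⁺¹ _))) ⟩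
    Eʲ⁺¹ ℚ.* S ℚ.* ∏Γ⁺ c    ≡⟨ solve 3 (λ e s p → e :* s :* p := e :* (p :* s)) refl Eʲ⁺¹ S (∏Γ⁺ c) ⟩
    Eʲ⁺¹ ℚ.* (∏Γ⁺ c ℚ.* S)  ≤⟨ ℚ.*-monoˡ-≤-nonNeg Eʲ⁺¹ {{ℚ.nonNegative (0≤^ℚ 0≤1-ε (suc j))}} (∏Γ⁺*∑odds≤1 c) ⟩
    Eʲ⁺¹ ℚ.* 1ℚ             ≡⟨ ℚ.*-identityʳ Eʲ⁺¹ ⟩
    Eʲ⁺¹                    ∎
    where
    open ℚ.≤-Reasoning
    Eʲ⁺¹ = E ^ℚ suc j
    S = ∑ (m Φ) λ c′ → when (Γ⁺? Φ c c′) (odds (x c′))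

  ∑-start≤ : ∀ K → ∑ (m Φ) (λ c → fromℕ ∣ edge Φ c ∣ ℚ.* (½ ^ℚ ∣ edge Φ c ∣ ℚ.* weight K c))
                  ≤ ∑ (m Φ) (λ c → odds (x c)) ℚ.* E ^ℚ suc K
  ∑-start≤ K = begin
    ∑ (m Φ) (λ c → fromℕ ∣ edge Φ c ∣ ℚ.* (½ ^ℚ ∣ edge Φ c ∣ ℚ.* weight K c))
      ≤⟨ ∑-mono-≤ (m Φ) (λ c → ℚ.≤-trans (start≤κ c) (κ*weight≤ K (weight*∏Γ⁺≤ K) c)) ⟩
    ∑ (m Φ) (λ c → E ^ℚ suc K ℚ.* odds (x c))  ≡⟨ sym (∑-*ˡ (m Φ) (E ^ℚ suc K) _) ⟩
    E ^ℚ suc K ℚ.* ∑ (m Φ) (λ c → odds (x c))  ≡⟨ ℚ.*-comm (E ^ℚ suc K) _ ⟩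
    ∑ (m Φ) (λ c → odds (x c)) ℚ.* E ^ℚ suc K  ∎
    where
    open ℚ.≤-Reasoning
    start≤κ : ∀ c → fromℕ ∣ edge Φ c ∣ ℚ.* (½ ^ℚ ∣ edge Φ c ∣ ℚ.* weight K c) ≤ κ c ℚ.* weight K c
    start≤κ c = subst (fromℕ k ℚ.* (½ ^ℚ k ℚ.* weight K c) ≤_) (sym (ℚ.*-assoc (fromℕ (2 * k)) (½ ^ℚ k) (weight K c)))
      (ℚ.*-monoʳ-≤-nonNeg (½ ^ℚ k ℚ.* weight K c) {{ℚ.nonNegative (0≤* (0≤½^ k) (0≤weight K c))}}
        (fromℕ-mono-≤ (ℕ.m≤n*m k 2)))
      where k = ∣ edge Φ c ∣

[L+2]/2≡1+L/2 : ∀ L → (suc L + 1) / 2 ≡ suc (L / 2)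
[L+2]/2≡1+L/2 L = trans (ℕ.m/n≡1+[m∸n]/n {suc L + 1} {2} (ℕ.s≤s (ℕ.m≤n+m 1 L))) (cong suc (ℕ./-congˡ (ℕ.m+n∸n≡m L 1)))

2*[L/2]<1+L : ∀ L → 2 * (L / 2) ℕ.< suc L
2*[L/2]<1+L L = ℕ.s≤s (ℕ.≤-trans (ℕ.≤-reflexive (ℕ.*-comm 2 (L / 2))) (ℕ.m/n*n≤m L 2))

lemma4p1 : (n : ℕ) .{{_ : NonZero n}} (Φ : Hypergraph n)
    (ε : ℚ) (x : Fin (m Φ) → ℚ) →
    (0ℚ < ε × ε < 1ℚ) →
    (∀ C → 0ℚ < x C × x C < 1ℚ) →
    (∀ C → ((+ (2 * ∣ edge Φ C ∣)) Q./ 1) Q.* (½ ^ℚ ∣ edge Φ C ∣)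
             ≤ ((1ℚ - ε) Q.* x C) Q.* prodΓ Φ x C) →
    (L : ℕ) →
    PrBAtMost Φ L (∑ (m Φ) (λ C → odds (x C)) Q.* ((1ℚ - ε) ^ℚ ((L + 1) / 2)))
lemma4p1 _ Φ ε x 0<ε<1 0<x<1 κ≤ zero =
  PrAtMost-⊥ (λ { (_ , _ , _ , _ , () , _) })
    (0≤* (0≤∑ (m Φ) λ c → 0≤odds (0≤x c) (proj₂ (0<x<1 c))) (0≤^ℚ 0≤1-ε 0))
  where open WeightBound Φ ε x 0<ε<1 0<x<1 κ≤
lemma4p1 n Φ ε x 0<ε<1 0<x<1 κ≤ (suc L) =
  PrAtMost-mono {P = ChainFromT K} (Event⇒ChainFromT (suc L) K (2*[L/2]<1+L L) _) bound (PrAtMost-ChainFromT K)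
  where
  open Weights Φ
  open WeightBound Φ ε x 0<ε<1 0<x<1 κ≤
  open Witnesses Φ (n * (suc L + 1))
  K = L / 2
  S = ∑ (m Φ) λ c → odds (x c)
  bound : ∑ (m Φ) (λ c → fromℕ ∣ edge Φ c ∣ ℚ.* (½ ^ℚ ∣ edge Φ c ∣ ℚ.* weight K c)) ≤ S ℚ.* E ^ℚ ((suc L + 1) / 2)
  bound = ℚ.≤-trans (∑-start≤ K) (ℚ.≤-reflexive (cong (λ k → S ℚ.* E ^ℚ k) (sym ([L+2]/2≡1+L/2 L))))
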